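{- Let $m$ be a positive integer and let $\sigma$ be a uniformly random permutation of $[n]$. Then \[ \mathbb P(\sigma\text{ has }m\text{ indecomposable parts})\approx\sum_{k\ge0}m\,\frac{\mathfrak{ip}_k^{(m-1)}-2\mathfrak{ip}_k^{(m)}+\mathfrak{ip}_k^{(m+1)}}{(n)_k}, \] and in particular \[ \mathbb P(\sigma\text{ is indecomposable})\approx1-\sum_{k\ge1}\frac{2\mathfrak{ip}_k-\mathfrak{ip}_k^{(2)}}{(n)_k}. \]
   Context: For a permutation $\sigma$ of $[n]$, its number of indecomposable parts is the largest $m$ such that $[n]$ is a disjoint union of $m$ nonempty intervals of consecutive integers $I_1,\dots,I_m$ with $\sigma(I_j)=I_j$ for all $j$; $\sigma$ is indecomposable if this number is $1$ (equivalently, no $k<n$ has $\sigma([k])=[k]$). $\mathfrak{ip}_k^{(m)}$ is the number of permutations of $[k]$ with exactly $m$ indecomposable parts ($\mathfrak{ip}_k=\mathfrak{ip}_k^{(1)}$), with convention $\mathfrak{ip}_0^{(0)}=1$, $\mathfrak{ip}_k^{(0)}=0$ for $k>0$. $(n)_k=n(n-1)\cdots(n-k+1)$. Notation: $x_n\approx\sum_{k\ge m}c_kf_k(n)$ means that for every $r\ge m$, $x_n=\sum_{k=m}^r c_kf_k(n)+O(f_{r+1}(n))$, and $f_{k+1}(n)=o(f_k(n))$ for every $k\ge m$ (the $c_k$ may be zero). -}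

module Defs where

open import Data.Nat as ℕ using (ℕ; zero; suc; _∸_; _≡ᵇ_; _<ᵇ_)
open import Data.Integer as ℤ using (ℤ; +_)
open import Data.Fin using (Fin; toℕ)
open import Data.Vec using (Vec; []; _∷_; lookup)
open import Data.List using (List; []; _∷_; [_]; map; concatMap; filterᵇ; length; allFin; applyUpTo; upTo; foldr)
open import Data.Bool using (Bool; true; not; _∨_; _∧_)
open import Data.Product using (Σ; _×_; ∃)
open import Data.Rational using (ℚ; _/_; 0ℚ; _+_; _-_; _*_; _≤_; _<_; ∣_∣)

allᵇ : ∀ {A : Set} → (A → Bool) → List A → Bool
allᵇ p xs = foldr _∧_ true (map p xs)

-- Permutations of [n] = {0,…,n-1} (0-indexed copy of {1,…,n}),
-- represented by their value table σ = (σ 0, …, σ (n-1)).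

allVecs : (n k : ℕ) → List (Vec (Fin n) k)
allVecs n zero    = [ [] ]
allVecs n (suc k) = concatMap (λ v → map (λ a → a ∷ v) (allFin n)) (allVecs n k)

injectiveᵇ : ∀ {n k} → Vec (Fin n) k → Bool
injectiveᵇ {n} {k} v =
  allᵇ (λ i → allᵇ (λ j → (toℕ i ≡ᵇ toℕ j) ∨ not (toℕ (lookup v i) ≡ᵇ toℕ (lookup v j)))
                 (allFin k))
      (allFin k)

perms : (n : ℕ) → List (Vec (Fin n) n)
perms n = filterᵇ injectiveᵇ (allVecs n n)

-- Indecomposable parts.
-- j ∈ {1,…,n} is a cut point of σ if σ maps the initial segment {0,…,j-1} into
-- (hence, σ being a bijection, onto) itself.  A decomposition of [n] into consecutive
-- intervals I₁,…,I_m with σ(I_t) = I_t is the same as a choice of interval endpoints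
-- that are all cut points and include n; hence the largest such m is the number of
-- cut points in {1,…,n}.  (For n = 0 this gives 0.)

isCutᵇ : ∀ {n} → Vec (Fin n) n → ℕ → Bool
isCutᵇ {n} σ j = allᵇ (λ i → not (toℕ i <ᵇ j) ∨ (toℕ (lookup σ i) <ᵇ j)) (allFin n)

numParts : ∀ {n} → Vec (Fin n) n → ℕ
numParts {n} σ = length (filterᵇ (isCutᵇ σ) (applyUpTo suc n))

ip : (k m : ℕ) → ℕ
ip k m = length (filterᵇ (λ σ → numParts σ ≡ᵇ m) (perms k))

ℕtoℚ : ℕ → ℚ
ℕtoℚ a = + a / 1

ℤtoℚ : ℤ → ℚ
ℤtoℚ a = a / 1

-- 1/d, with the (irrelevant) convention 1/0 := 0
invℕ : ℕ → ℚ
invℕ zero    = 0ℚ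
invℕ (suc d) = + 1 / suc d

fall : ℕ → ℕ → ℕ
fall n zero    = 1
fall n (suc k) = (n ∸ k) ℕ.* fall n k

probParts : (n m : ℕ) → ℚ
probParts n m = ℕtoℚ (ip n m) * invℕ (length (perms n))

f : ℕ → ℕ → ℚ
f k n = invℕ (fall n k)

-- Σ_{k=a}^{r} g k   (empty, i.e. 0, if r < a)
sumRange : ℕ → ℕ → (ℕ → ℚ) → ℚ
sumRange a r g = foldr _+_ 0ℚ (map (λ i → g (a ℕ.+ i)) (upTo (suc r ∸ a)))

BigO : (ℕ → ℚ) → (ℕ → ℚ) → Set
BigO x g = Σ ℚ λ C → Σ ℕ λ N → ∀ n → N ℕ.≤ n → ∣ x n ∣ ≤ C * ∣ g n ∣

LittleO : (ℕ → ℚ) → (ℕ → ℚ) → Set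
LittleO x g = ∀ (ε : ℚ) → 0ℚ < ε → Σ ℕ λ N → ∀ n → N ℕ.≤ n → ∣ x n ∣ ≤ ε * ∣ g n ∣

Approx : (ℕ → ℚ) → (ℕ → ℚ) → (ℕ → ℕ → ℚ) → ℕ → Set
Approx x c F m =
  (∀ r → m ℕ.≤ r → BigO (λ n → x n - sumRange m r (λ k → c k * F k n)) (F (suc r)))
  × (∀ k → m ℕ.≤ k → LittleO (F (suc k)) (F k))

-- m (𝔦𝔭_k^{(m-1)} - 2 𝔦𝔭_k^{(m)} + 𝔦𝔭_k^{(m+1)}), for m ≥ 1 (m = suc m')
coeffParts : ℕ → ℕ → ℚ
coeffParts m' k =
  ℕtoℚ (suc m') * ℤtoℚ ((+ ip k m' ℤ.- (+ 2) ℤ.* (+ ip k (suc m'))) ℤ.+ + ip k (suc (suc m')))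

-- coefficients of 1 - Σ_{k≥1} (2𝔦𝔭_k - 𝔦𝔭_k^{(2)})/(n)_k
coeffIndec : ℕ → ℚ
coeffIndec zero    = ℕtoℚ 1
coeffIndec (suc k) = ℤtoℚ (ℤ.- ((+ 2) ℤ.* (+ ip (suc k) 1) ℤ.- + ip (suc k) 2))

{-# OPTIONS --safe #-}
-- A permutation of [k + j] mapping [k] onto itself is a permutation of [k] glued to
-- one of [j], and gluing adds the numbers of indecomposable parts.  Summing over the cut points
-- of a permutation therefore gives, for the convolution (x ⋆ y) n = ∑_{k ≤ n} x k ⋅ y (n - k),
--   ip^(a) ⋆ ip^(b) = ip^(a+b)   and   (k ↦ k!) ⋆ ip^(b) = n! - ∑_{q < b} ip^(q).
--
-- Say an integer sequence a has an expansion of order r with coefficients α if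
-- a n = ∑_{k ≤ r} α k ⋅ (n - k)! + O((n - r - 1)!).  If 0 ≤ a n, b n ≤ n!, b 0 = 0, a has
-- expansions (coefficients α) of all orders below r and b (coefficients β) of all orders up
-- to r, then a ⋆ b has one of order r with coefficients a ⋆ β + b ⋆ α: the r + 1 terms at
-- either end of the convolution are handled by the expansions of b and a, and the remaining
-- middle terms add up to O((n - r - 1)!) because j! (n - j)! is largest for j at the ends.
-- As ip^(1) = n! - ip^(1) ⋆ (k ↦ k!, but 0 at k = 0) - ip^(0), strong induction on r expands
-- ip^(1); then ip^(m+1) = ip^(m) ⋆ ip^(1) expands every ip^(m).  Dividing by n! turns
-- (n - k)!/n! into 1/(n)_k.

module Submission where

open import Defs
open import Algebra.Bundles using (CommutativeSemiring; CommutativeRing)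
open import Data.Bool using (Bool; true; false; T; not; _∧_; _∨_)
open import Data.Bool.Properties using (T-∧; T-∨; ∨-comm)
open import Data.Empty using (⊥-elim)
import Data.Fin as Fin
import Data.Fin.Properties as FinP
import Data.Integer as ℤ
import Data.Integer.Properties as ℤP
import Data.List as List
import Data.List.Properties as ListP
open import Data.Nat using (ℕ; zero; suc; _∸_)
import Data.Nat as ℕ
import Data.Nat.Properties as ℕP
open import Data.Product using (Σ-syntax; _×_; _,_; proj₁; proj₂)
import Data.Rational as ℚ
import Data.Rational.Properties as ℚP
open import Data.Sum using (inj₁; inj₂)
import Data.Vec as Vec
import Data.Vec.Properties as VecP
open import Function using (_∘_; Injective; Equivalence)
open import Relation.Nullary using (¬_; contradiction; yes; no)
open import Relation.Binary.PropositionalEquality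
  using (_≡_; _≢_; refl; sym; trans; cong; cong₂; subst; subst₂; module ≡-Reasoning)

module RangeSum {c ℓ} (S : CommutativeSemiring c ℓ) where

  open CommutativeSemiring S renaming (refl to ≈-refl; sym to ≈-sym; trans to ≈-trans)
  open import Algebra.Properties.CommutativeSemigroup +-commutativeSemigroup using (interchange)
  open import Relation.Binary.Reasoning.Setoid setoid

  ∑ : ℕ → (ℕ → Carrier) → Carrier
  ∑ zero    g = 0#
  ∑ (suc n) g = ∑ n g + g n

  ∑-cong : ∀ n {g h : ℕ → Carrier} → (∀ i → i ℕ.< n → g i ≈ h i) → ∑ n g ≈ ∑ n h
  ∑-cong zero    g≈h = ≈-refl
  ∑-cong (suc n) g≈h = +-cong (∑-cong n (λ i i<n → g≈h i (ℕP.m<n⇒m<1+n i<n))) (g≈h n ℕP.≤-refl)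

  ∑-zero : ∀ n → ∑ n (λ _ → 0#) ≈ 0#
  ∑-zero zero    = ≈-refl
  ∑-zero (suc n) = ≈-trans (+-identityʳ _) (∑-zero n)

  ∑-+ : ∀ n (g h : ℕ → Carrier) → ∑ n (λ i → g i + h i) ≈ ∑ n g + ∑ n h
  ∑-+ zero    g h = ≈-sym (+-identityˡ 0#)
  ∑-+ (suc n) g h = ≈-trans (+-congʳ (∑-+ n g h)) (interchange _ _ _ _)

  ∑-*ˡ : ∀ n x (g : ℕ → Carrier) → ∑ n (λ i → x * g i) ≈ x * ∑ n g
  ∑-*ˡ zero    x g = ≈-sym (zeroʳ x)
  ∑-*ˡ (suc n) x g = ≈-trans (+-congʳ (∑-*ˡ n x g)) (≈-sym (distribˡ x _ _))

  ∑-*ʳ : ∀ n x (g : ℕ → Carrier) → ∑ n (λ i → g i * x) ≈ ∑ n g * x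
  ∑-*ʳ zero    x g = ≈-sym (zeroˡ x)
  ∑-*ʳ (suc n) x g = ≈-trans (+-congʳ (∑-*ʳ n x g)) (≈-sym (distribʳ x _ _))

  ∑-head : ∀ n g → ∑ (suc n) g ≈ g 0 + ∑ n (λ i → g (suc i))
  ∑-head zero    g = +-comm 0# (g 0)
  ∑-head (suc n) g = ≈-trans (+-congʳ (∑-head n g)) (+-assoc _ _ _)

  ∑-split : ∀ m n g → ∑ (m ℕ.+ n) g ≈ ∑ m g + ∑ n (λ i → g (m ℕ.+ i))
  ∑-split m zero    g rewrite ℕP.+-identityʳ m = ≈-sym (+-identityʳ _)
  ∑-split m (suc n) g rewrite ℕP.+-suc m n = ≈-trans (+-congʳ (∑-split m n g)) (+-assoc _ _ _)

  ∑-reverse : ∀ n g → ∑ (suc n) g ≈ ∑ (suc n) (λ i → g (n ∸ i))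
  ∑-reverse zero    g = ≈-refl
  ∑-reverse (suc n) g = begin
    ∑ (suc n) g + g (suc n)                         ≈⟨ +-congʳ (∑-reverse n g) ⟩
    ∑ (suc n) (λ i → g (n ∸ i)) + g (suc n)         ≈⟨ +-comm _ _ ⟩
    g (suc n) + ∑ (suc n) (λ i → g (n ∸ i))         ≈⟨ ∑-head (suc n) (λ i → g (suc n ∸ i)) ⟨
    ∑ (suc (suc n)) (λ i → g (suc n ∸ i))           ∎

  ∑-triangle : ∀ r (F : ℕ → ℕ → Carrier) →
    ∑ (suc r) (λ t → ∑ (suc t) (λ j → F j (t ∸ j))) ≈ ∑ (suc r) (λ j → ∑ (suc (r ∸ j)) (F j))
  ∑-triangle zero    F = ≈-refl
  ∑-triangle (suc r) F = begin
    ∑ (suc r) (λ t → ∑ (suc t) (λ j → F j (t ∸ j))) + (diagonal + F (suc r) (r ∸ r))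
      ≈⟨ +-cong (∑-triangle r F) (+-congˡ (reflexive (cong (F (suc r)) (ℕP.n∸n≡0 r)))) ⟩
    ∑ (suc r) (λ j → ∑ (suc (r ∸ j)) (F j)) + (diagonal + F (suc r) 0)
      ≈⟨ +-assoc _ _ _ ⟨
    (∑ (suc r) (λ j → ∑ (suc (r ∸ j)) (F j)) + diagonal) + F (suc r) 0
      ≈⟨ +-cong (≈-sym (∑-+ (suc r) _ _)) (≈-sym (+-identityˡ _)) ⟩
    ∑ (suc r) (λ j → ∑ (suc (r ∸ j)) (F j) + F j (suc r ∸ j)) + ∑ 1 (F (suc r))
      ≈⟨ +-congʳ (∑-cong (suc r) (λ j j≤r → column j (ℕP.≤-pred j≤r))) ⟨
    ∑ (suc r) (λ j → ∑ (suc (suc r ∸ j)) (F j)) + ∑ 1 (F (suc r))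
      ≈⟨ +-congˡ (reflexive (cong (λ d → ∑ (suc d) (F (suc r))) (ℕP.n∸n≡0 r))) ⟨
    ∑ (suc (suc r)) (λ j → ∑ (suc (suc r ∸ j)) (F j))  ∎
    where
    diagonal = ∑ (suc r) (λ j → F j (suc r ∸ j))
    column : ∀ j → j ℕ.≤ r → ∑ (suc (suc r ∸ j)) (F j) ≈ ∑ (suc (r ∸ j)) (F j) + F j (suc r ∸ j)
    column j j≤r rewrite ℕP.+-∸-assoc 1 j≤r = ≈-refl

  _⋆_ : (ℕ → Carrier) → (ℕ → Carrier) → ℕ → Carrier
  (g ⋆ h) n = ∑ (suc n) (λ j → g j * h (n ∸ j))

  ⋆-cong : ∀ {g g′ h h′ : ℕ → Carrier} → (∀ i → g i ≈ g′ i) → (∀ i → h i ≈ h′ i) →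
           ∀ n → (g ⋆ h) n ≈ (g′ ⋆ h′) n
  ⋆-cong g≈g′ h≈h′ n = ∑-cong (suc n) (λ j _ → *-cong (g≈g′ j) (h≈h′ (n ∸ j)))

  ⋆-comm : ∀ g h n → (g ⋆ h) n ≈ (h ⋆ g) n
  ⋆-comm g h n = begin
    ∑ (suc n) (λ j → g j * h (n ∸ j))
      ≈⟨ ∑-reverse n _ ⟩
    ∑ (suc n) (λ j → g (n ∸ j) * h (n ∸ (n ∸ j)))
      ≈⟨ ∑-cong (suc n) (λ j j≤n → ≈-trans (*-comm _ _)
                                     (*-congʳ (reflexive (cong h (ℕP.m∸[m∸n]≡n (ℕP.≤-pred j≤n)))))) ⟩
    ∑ (suc n) (λ j → h j * g (n ∸ j))
      ∎

  ⋆-distribˡ-+ : ∀ g h h′ n → (g ⋆ (λ i → h i + h′ i)) n ≈ (g ⋆ h) n + (g ⋆ h′) n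
  ⋆-distribˡ-+ g h h′ n = ≈-trans (∑-cong (suc n) (λ j _ → distribˡ (g j) _ _)) (∑-+ (suc n) _ _)

  δ : ℕ → Carrier
  δ zero    = 1#
  δ (suc _) = 0#

  ⋆-identityˡ : ∀ g n → (δ ⋆ g) n ≈ g n
  ⋆-identityˡ g n = begin
    ∑ (suc n) (λ j → δ j * g (n ∸ j))
      ≈⟨ ∑-head n _ ⟩
    1# * g n + ∑ n (λ j → 0# * g (n ∸ suc j))
      ≈⟨ +-cong (*-identityˡ (g n)) (≈-trans (∑-cong n (λ j _ → zeroˡ _)) (∑-zero n)) ⟩
    g n + 0#
      ≈⟨ +-identityʳ (g n) ⟩
    g n
      ∎

  ⋆-identityʳ : ∀ g n → (g ⋆ δ) n ≈ g n
  ⋆-identityʳ g n = ≈-trans (⋆-comm g δ n) (⋆-identityˡ g n)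

  ⋆-split : ∀ g h p m → (g ⋆ h) (p ℕ.+ m) ≈ ∑ p (λ j → g j * h (p ℕ.+ m ∸ j)) + ((λ i → g (p ℕ.+ i)) ⋆ h) m
  ⋆-split g h p m = begin
    ∑ (suc (p ℕ.+ m)) (λ j → g j * h (p ℕ.+ m ∸ j))
      ≈⟨ reflexive (cong (λ k → ∑ k (λ j → g j * h (p ℕ.+ m ∸ j))) (sym (ℕP.+-suc p m))) ⟩
    ∑ (p ℕ.+ suc m) (λ j → g j * h (p ℕ.+ m ∸ j))
      ≈⟨ ∑-split p (suc m) _ ⟩
    ∑ p (λ j → g j * h (p ℕ.+ m ∸ j)) + ∑ (suc m) (λ i → g (p ℕ.+ i) * h (p ℕ.+ m ∸ (p ℕ.+ i)))
      ≈⟨ +-congˡ (∑-cong (suc m) (λ i _ → reflexive (cong (λ k → g (p ℕ.+ i) * h k) (ℕP.[m+n]∸[m+o]≡n∸o p m i)))) ⟩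
    ∑ p (λ j → g j * h (p ℕ.+ m ∸ j)) + ((λ i → g (p ℕ.+ i)) ⋆ h) m
      ∎

  ⋆-ends : ∀ g h p t → let n = p ℕ.+ (p ℕ.+ t) in
    (g ⋆ h) n ≈ ∑ p (λ j → g j * h (n ∸ j))
                + (∑ p (λ i → h i * g (n ∸ i)) + ((λ i → h (p ℕ.+ i)) ⋆ (λ i → g (p ℕ.+ i))) t)
  ⋆-ends g h p t = begin
    (g ⋆ h) n
      ≈⟨ ⋆-split g h p (p ℕ.+ t) ⟩
    ∑ p (λ j → g j * h (n ∸ j)) + (g′ ⋆ h) (p ℕ.+ t)
      ≈⟨ +-congˡ (⋆-comm g′ h (p ℕ.+ t)) ⟩
    ∑ p (λ j → g j * h (n ∸ j)) + (h ⋆ g′) (p ℕ.+ t)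
      ≈⟨ +-congˡ (⋆-split h g′ p t) ⟩
    ∑ p (λ j → g j * h (n ∸ j)) + (∑ p (λ i → h i * g′ (p ℕ.+ t ∸ i)) + ((λ i → h (p ℕ.+ i)) ⋆ g′) t)
      ≈⟨ +-congˡ (+-congʳ (∑-cong p (λ i i<p → reflexive (cong (λ k → h i * g k)
           (sym (ℕP.+-∸-assoc p (ℕP.≤-trans (ℕP.<⇒≤ i<p) (ℕP.m≤m+n p t)))))))) ⟩
    ∑ p (λ j → g j * h (n ∸ j)) + (∑ p (λ i → h i * g (n ∸ i)) + ((λ i → h (p ℕ.+ i)) ⋆ g′) t)
      ∎
    where
    n = p ℕ.+ (p ℕ.+ t)
    g′ : ℕ → Carrier
    g′ i = g (p ℕ.+ i)

module Sumℕ = RangeSum ℕP.+-*-commutativeSemiring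

∑-mono : ∀ n {g h : ℕ → ℕ} → (∀ i → i ℕ.< n → g i ℕ.≤ h i) → Sumℕ.∑ n g ℕ.≤ Sumℕ.∑ n h
∑-mono zero    g≤h = ℕ.z≤n
∑-mono (suc n) g≤h = ℕP.+-mono-≤ (∑-mono n (λ i i<n → g≤h i (ℕP.m<n⇒m<1+n i<n))) (g≤h n ℕP.≤-refl)

⋆-mono : ∀ {g g′ h h′ : ℕ → ℕ} → (∀ i → g i ℕ.≤ g′ i) → (∀ i → h i ℕ.≤ h′ i) →
         ∀ n → (g Sumℕ.⋆ h) n ℕ.≤ (g′ Sumℕ.⋆ h′) n
⋆-mono g≤g′ h≤h′ n = ∑-mono (suc n) (λ j _ → ℕP.*-mono-≤ (g≤g′ j) (h≤h′ (n ∸ j)))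

∑-const : ∀ n c → Sumℕ.∑ n (λ _ → c) ≡ n ℕ.* c
∑-const zero    c = refl
∑-const (suc n) c = trans (ℕP.+-comm (Sumℕ.∑ n (λ _ → c)) c) (cong (c ℕ.+_) (∑-const n c))

module Sumℤ = RangeSum ℤP.+-*-commutativeSemiring

module Sumℚ = RangeSum (CommutativeRing.commutativeSemiring ℚP.+-*-commutativeRing)

module Factorials where

  open Data.Nat using (_+_; _*_; _≤_; _<_; _!; z≤n; s≤s)
  open import Data.Nat.Solver using (module +-*-Solver)
  open +-*-Solver using (solve; _:*_; _:+_; _:=_; con)
  open Sumℕ

  fall-*-! : ∀ n k → k ≤ n → fall n k * (n ∸ k) ! ≡ n !
  fall-*-! n zero    _   = ℕP.*-identityˡ (n !)
  fall-*-! n (suc k) k<n = begin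
    (n ∸ k) * fall n k * (n ∸ suc k) !     ≡⟨ cong (_* (n ∸ suc k) !) (ℕP.*-comm (n ∸ k) (fall n k)) ⟩
    fall n k * (n ∸ k) * (n ∸ suc k) !     ≡⟨ ℕP.*-assoc (fall n k) (n ∸ k) _ ⟩
    fall n k * ((n ∸ k) * (n ∸ suc k) !)   ≡⟨ cong (fall n k *_) (peel (ℕP.+-∸-assoc 1 k<n)) ⟩
    fall n k * (n ∸ k) !                   ≡⟨ fall-*-! n k (ℕP.<⇒≤ k<n) ⟩
    n !                                    ∎
    where
    open ≡-Reasoning
    peel : ∀ {d e} → d ≡ suc e → d * e ! ≡ d !
    peel refl = refl

  fall-n-n : ∀ n → fall n n ≡ n !
  fall-n-n n = trans (sym (ℕP.*-identityʳ _)) (trans (cong (λ d → fall n n * d !) (sym (ℕP.n∸n≡0 n))) (fall-*-! n n ℕP.≤-refl))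

  !*!-shift : ∀ j m → j ≤ m → suc j ! * m ! ≤ j ! * suc m !
  !*!-shift j m j≤m = begin
    suc j ! * m !          ≡⟨ ℕP.*-assoc (suc j) (j !) (m !) ⟩
    suc j * (j ! * m !)    ≤⟨ ℕP.*-monoˡ-≤ (j ! * m !) (s≤s j≤m) ⟩
    suc m * (j ! * m !)    ≡⟨ solve 3 (λ x y z → x :* (y :* z) := y :* (x :* z)) refl (suc m) (j !) (m !) ⟩
    j ! * suc m !          ∎
    where open ℕP.≤-Reasoning

  !*!-spread : ∀ d a m → a + d ≤ m → (a + d) ! * m ! ≤ a ! * (d + m) !
  !*!-spread zero    a m _ rewrite ℕP.+-identityʳ a = ℕP.≤-refl
  !*!-spread (suc d) a m a+d<m rewrite ℕP.+-suc a d = ℕP.≤-trans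
    (!*!-shift (a + d) m (ℕP.<⇒≤ a+d<m))
    (subst (λ e → (a + d) ! * suc m ! ≤ a ! * e !) (ℕP.+-suc d m) (!*!-spread d a (suc m) (ℕP.m≤n⇒m≤1+n (ℕP.<⇒≤ a+d<m))))

  !*!-≤ : ∀ a j m → a ≤ j → a ≤ m → j ! * m ! ≤ a ! * (j + m ∸ a) !
  !*!-≤ a j m a≤j a≤m with j ℕP.≤? m
  ... | yes j≤m = subst₂ (λ x y → x ! * m ! ≤ a ! * y !) (ℕP.m+[n∸m]≡n a≤j) (sym (ℕP.+-∸-comm m a≤j))
    (!*!-spread (j ∸ a) a m (subst (_≤ m) (sym (ℕP.m+[n∸m]≡n a≤j)) j≤m))
  ... | no  j≰m = subst₂ (λ x y → x ≤ a ! * y !)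
    (ℕP.*-comm (m !) (j !)) (trans (sym (ℕP.+-∸-comm j a≤m)) (cong (_∸ a) (ℕP.+-comm m j)))
    (subst (λ x → x ! * j ! ≤ a ! * ((m ∸ a) + j) !) (ℕP.m+[n∸m]≡n a≤m)
      (!*!-spread (m ∸ a) a j (subst (_≤ j) (sym (ℕP.m+[n∸m]≡n a≤m)) (ℕP.<⇒≤ (ℕP.≰⇒> j≰m)))))

  !*!-inner : ∀ r t i → i < t → (suc r + suc i) ! * (suc r + (t ∸ i)) ! ≤ suc (suc r) ! * (suc r + t) !
  !*!-inner r t i i<t = subst (λ x → (suc r + suc i) ! * (suc r + (t ∸ i)) ! ≤ suc (suc r) ! * x !) total
    (!*!-≤ (suc (suc r)) (suc r + suc i) (suc r + (t ∸ i))
      (subst (_≤ suc r + suc i) (ℕP.+-comm (suc r) 1) (ℕP.+-monoʳ-≤ (suc r) (s≤s z≤n)))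
      (subst (_≤ suc r + (t ∸ i)) (ℕP.+-comm (suc r) 1) (ℕP.+-monoʳ-≤ (suc r) (ℕP.m<n⇒0<n∸m i<t))))
    where
    total : suc r + suc i + (suc r + (t ∸ i)) ∸ suc (suc r) ≡ suc r + t
    total = trans (cong (_∸ suc (suc r)) (solve 3 (λ r i d → (con 1 :+ r) :+ (con 1 :+ i) :+ ((con 1 :+ r) :+ d)
                                                   := (con 1 :+ (con 1 :+ r)) :+ ((con 1 :+ r) :+ (i :+ d))) refl r i (t ∸ i)))
                  (trans (ℕP.m+n∸m≡n (suc (suc r)) _) (cong (suc r +_) (ℕP.m+[n∸m]≡n (ℕP.<⇒≤ i<t))))

  middleConstant : ℕ → ℕ
  middleConstant r = 2 * suc r ! + suc (suc r) !

  -- The two end terms are (r+1)! (r+1+t)!; by !*!-≤ each of the t - 1 inner ones is at most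
  -- (r+2)! (r+t)!, and (t - 1) (r+t)! ≤ (r+1+t)!.
  middle-bound : ∀ r t → ((λ i → (suc r + i) !) ⋆ (λ i → (suc r + i) !)) t ≤ middleConstant r * (suc r + t) !
  middle-bound r zero rewrite ℕP.+-identityʳ r =
    ℕP.*-monoˡ-≤ (suc r !) (ℕP.≤-trans (ℕP.m≤m+n (suc r !) (suc r ! + 0)) (ℕP.m≤m+n (2 * suc r !) _))
  middle-bound r (suc t) = begin
    ∑ (suc (suc t)) term
      ≡⟨ ∑-head (suc t) term ⟩
    term 0 + (∑ t (term ∘ suc) + term (suc t))
      ≤⟨ ℕP.+-monoʳ-≤ (term 0) (ℕP.+-monoˡ-≤ (term (suc t)) inner) ⟩
    term 0 + (t * (suc (suc r) ! * (suc r + t) !) + term (suc t))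
      ≡⟨ cong₂ (λ x y → x + (t * (suc (suc r) ! * (suc r + t) !) + y)) first last ⟩
    suc r ! * F + (t * (suc (suc r) ! * (suc r + t) !) + suc r ! * F)
      ≤⟨ ℕP.+-monoʳ-≤ (suc r ! * F) (ℕP.+-monoˡ-≤ (suc r ! * F) count) ⟩
    suc r ! * F + (suc (suc r) ! * F + suc r ! * F)
      ≡⟨ solve 3 (λ x y z → x :* z :+ (y :* z :+ x :* z) := (con 2 :* x :+ y) :* z) refl (suc r !) (suc (suc r) !) F ⟩
    middleConstant r * F
      ∎
    where
    open ℕP.≤-Reasoning
    F = (suc r + suc t) !
    term : ℕ → ℕ
    term j = (suc r + j) ! * (suc r + (suc t ∸ j)) !
    first : term 0 ≡ suc r ! * F
    first = cong (λ x → x ! * F) (ℕP.+-identityʳ (suc r))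
    last : term (suc t) ≡ suc r ! * F
    last = trans (cong (λ x → F * (suc r + x) !) (ℕP.n∸n≡0 t))
                 (trans (cong (λ x → F * x !) (ℕP.+-identityʳ (suc r))) (ℕP.*-comm F (suc r !)))
    inner : ∑ t (term ∘ suc) ≤ t * (suc (suc r) ! * (suc r + t) !)
    inner = ℕP.≤-trans (∑-mono t (!*!-inner r t)) (ℕP.≤-reflexive (∑-const t _))
    count : t * (suc (suc r) ! * (suc r + t) !) ≤ suc (suc r) ! * F
    count = begin
      t * (suc (suc r) ! * (suc r + t) !)
        ≡⟨ solve 3 (λ a b c → a :* (b :* c) := b :* (a :* c)) refl t (suc (suc r) !) ((suc r + t) !) ⟩
      suc (suc r) ! * (t * (suc r + t) !)
        ≤⟨ ℕP.*-monoʳ-≤ (suc (suc r) !) (ℕP.*-monoˡ-≤ ((suc r + t) !) (ℕP.≤-trans (ℕP.m≤n+m t (suc r)) (ℕP.n≤1+n _))) ⟩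
      suc (suc r) ! * (suc (suc r + t) * (suc r + t) !)
        ≡⟨ cong (λ x → suc (suc r) ! * x !) (sym (ℕP.+-suc (suc r) t)) ⟩
      suc (suc r) ! * F
        ∎

module Permutations where

  open Factorials using (fall-n-n)
  open Data.Nat using (_+_; _*_; _<_; _≡ᵇ_; _!)
  open Fin using (Fin; zero; suc; toℕ)
  open List using (List; []; _∷_; map; concatMap; filterᵇ; length; allFin; applyUpTo; tabulate)
  open Vec using (Vec; []; _∷_; lookup; _++_)
  open import Data.List.Relation.Unary.All.Properties using (all⁺; all⁻; tabulate⁺; tabulate⁻)
  open import Algebra.Properties.Semiring.Sum ℕP.+-*-semiring using (sum; sum-cong-≗; ∑-distrib-+; *-distribˡ-sum; sum-replicate-zero)
  open import Algebra.Properties.CommutativeSemigroup ℕP.+-commutativeSemigroup using () renaming (interchange to +-interchange)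
  open ≡-Reasoning
  open Sumℕ

  χ : Bool → ℕ
  χ true  = 1
  χ false = 0

  T-ext : ∀ {a b} → (T a → T b) → (T b → T a) → a ≡ b
  T-ext {false} {false} _   _   = refl
  T-ext {false} {true}  _   b⇒a = ⊥-elim (b⇒a _)
  T-ext {true}  {false} a⇒b _   = ⊥-elim (a⇒b _)
  T-ext {true}  {true}  _   _   = refl

  T-not⁻ : ∀ {b} → T (not b) → ¬ T b
  T-not⁻ {false} _ ()

  T-not⁺ : ∀ {b} → ¬ T b → T (not b)
  T-not⁺ {false} _   = _
  T-not⁺ {true}  ¬tt = ¬tt _

  T-not∨⁻ : ∀ {b c} → T (not b ∨ c) → T b → T c
  T-not∨⁻ {true} t _ = t

  T-not∨⁺ : ∀ {b c} → (T b → T c) → T (not b ∨ c)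
  T-not∨⁺ {false} _   = _
  T-not∨⁺ {true}  b⇒c = b⇒c _

  χ-T : ∀ {b} → T b → χ b ≡ 1
  χ-T {true} _ = refl

  χ-¬T : ∀ {b} → ¬ T b → χ b ≡ 0
  χ-¬T {false} _   = refl
  χ-¬T {true}  ¬tt = ⊥-elim (¬tt _)

  χ-∧ : ∀ a b → χ (a ∧ b) ≡ χ a * χ b
  χ-∧ true  b = sym (ℕP.+-identityʳ (χ b))
  χ-∧ false b = refl

  χ-∨ : ∀ a b → ¬ (T a × T b) → χ (a ∨ b) ≡ χ a + χ b
  χ-∨ true  true  ¬both = ⊥-elim (¬both _)
  χ-∨ true  false _     = refl
  χ-∨ false b     _     = refl

  χ-not : ∀ a → χ (not a) + χ a ≡ 1
  χ-not true  = refl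
  χ-not false = refl

  allᵇ-allFin⁻ : ∀ {n} (p : Fin n → Bool) → T (allᵇ p (allFin n)) → ∀ i → T (p i)
  allᵇ-allFin⁻ p t = tabulate⁻ (all⁺ p _ t)

  allᵇ-allFin⁺ : ∀ {n} (p : Fin n → Bool) → (∀ i → T (p i)) → T (allᵇ p (allFin n))
  allᵇ-allFin⁺ p h = all⁻ p (tabulate⁺ h)

  LookupInjective : ∀ {n L} → Vec (Fin n) L → Set
  LookupInjective v = Injective _≡_ _≡_ (lookup v)

  injectiveᵇ-sound : ∀ {n L} (v : Vec (Fin n) L) → T (injectiveᵇ v) → LookupInjective v
  injectiveᵇ-sound v t {i} {j} vi≡vj
    with Equivalence.to T-∨ (allᵇ-allFin⁻ _ (allᵇ-allFin⁻ _ t i) j)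
  ... | inj₁ i≡ᵇj   = FinP.toℕ-injective (ℕP.≡ᵇ⇒≡ _ _ i≡ᵇj)
  ... | inj₂ vi≢ᵇvj = contradiction (ℕP.≡⇒≡ᵇ _ _ (cong toℕ vi≡vj)) (T-not⁻ vi≢ᵇvj)

  injectiveᵇ-complete : ∀ {n L} (v : Vec (Fin n) L) → LookupInjective v → T (injectiveᵇ v)
  injectiveᵇ-complete {L = L} v inj = allᵇ-allFin⁺ row λ i → allᵇ-allFin⁺ (entry i) (entry-true i)
    where
    entry : Fin L → Fin L → Bool
    entry i j = (toℕ i ≡ᵇ toℕ j) ∨ not (toℕ (lookup v i) ≡ᵇ toℕ (lookup v j))
    row : Fin L → Bool
    row i = allᵇ (entry i) (allFin L)
    entry-true : ∀ i j → T (entry i j)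
    entry-true i j = subst T (∨-comm (not (toℕ (lookup v i) ≡ᵇ toℕ (lookup v j))) (toℕ i ≡ᵇ toℕ j))
      (T-not∨⁺ λ vi≡ᵇvj → ℕP.≡⇒≡ᵇ _ _ (cong toℕ (inj (FinP.toℕ-injective (ℕP.≡ᵇ⇒≡ _ _ vi≡ᵇvj)))))

  IsCut : ∀ {n} → Vec (Fin n) n → ℕ → Set
  IsCut σ p = ∀ i → toℕ i < p → toℕ (lookup σ i) < p

  isCutᵇ-sound : ∀ {n} (σ : Vec (Fin n) n) p → T (isCutᵇ σ p) → IsCut σ p
  isCutᵇ-sound σ p t i i<p = ℕP.<ᵇ⇒< _ _ (T-not∨⁻ (allᵇ-allFin⁻ _ t i) (ℕP.<⇒<ᵇ i<p))

  isCutᵇ-complete : ∀ {n} (σ : Vec (Fin n) n) p → IsCut σ p → T (isCutᵇ σ p)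
  isCutᵇ-complete σ p cut = allᵇ-allFin⁺ _ λ i → T-not∨⁺ λ i<ᵇp → ℕP.<⇒<ᵇ (cut i (ℕP.<ᵇ⇒< _ _ i<ᵇp))

  private
    variable
      A B : Set

  ∑ₗ : List A → (A → ℕ) → ℕ
  ∑ₗ []       h = 0
  ∑ₗ (x ∷ xs) h = h x + ∑ₗ xs h

  ∑ₗ-cong : ∀ (xs : List A) {h g : A → ℕ} → (∀ x → h x ≡ g x) → ∑ₗ xs h ≡ ∑ₗ xs g
  ∑ₗ-cong []       h≡g = refl
  ∑ₗ-cong (x ∷ xs) h≡g = cong₂ _+_ (h≡g x) (∑ₗ-cong xs h≡g)

  ∑ₗ-zero : ∀ (xs : List A) → ∑ₗ xs (λ _ → 0) ≡ 0
  ∑ₗ-zero []       = refl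
  ∑ₗ-zero (x ∷ xs) = ∑ₗ-zero xs

  ∑ₗ-+ : ∀ (xs : List A) (h g : A → ℕ) → ∑ₗ xs (λ x → h x + g x) ≡ ∑ₗ xs h + ∑ₗ xs g
  ∑ₗ-+ []       h g = refl
  ∑ₗ-+ (x ∷ xs) h g = trans (cong (h x + g x +_) (∑ₗ-+ xs h g)) (+-interchange (h x) (g x) _ _)

  ∑ₗ-*ˡ : ∀ (xs : List A) c (h : A → ℕ) → ∑ₗ xs (λ x → c * h x) ≡ c * ∑ₗ xs h
  ∑ₗ-*ˡ []       c h = sym (ℕP.*-zeroʳ c)
  ∑ₗ-*ˡ (x ∷ xs) c h = trans (cong (c * h x +_) (∑ₗ-*ˡ xs c h)) (sym (ℕP.*-distribˡ-+ c (h x) _))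

  ∑ₗ-*ʳ : ∀ (xs : List A) c (h : A → ℕ) → ∑ₗ xs (λ x → h x * c) ≡ ∑ₗ xs h * c
  ∑ₗ-*ʳ []       c h = refl
  ∑ₗ-*ʳ (x ∷ xs) c h = trans (cong (h x * c +_) (∑ₗ-*ʳ xs c h)) (sym (ℕP.*-distribʳ-+ c (h x) _))

  ∑ₗ-++ : ∀ (xs ys : List A) (h : A → ℕ) → ∑ₗ (xs List.++ ys) h ≡ ∑ₗ xs h + ∑ₗ ys h
  ∑ₗ-++ []       ys h = refl
  ∑ₗ-++ (x ∷ xs) ys h = trans (cong (h x +_) (∑ₗ-++ xs ys h)) (sym (ℕP.+-assoc (h x) _ _))

  length-filterᵇ : ∀ (p : A → Bool) xs → length (filterᵇ p xs) ≡ ∑ₗ xs (χ ∘ p)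
  length-filterᵇ p []       = refl
  length-filterᵇ p (x ∷ xs) with p x
  ... | true  = cong suc (length-filterᵇ p xs)
  ... | false = length-filterᵇ p xs

  ∑ₗ-filterᵇ : ∀ (p : A → Bool) xs (h : A → ℕ) → ∑ₗ (filterᵇ p xs) h ≡ ∑ₗ xs (λ x → χ (p x) * h x)
  ∑ₗ-filterᵇ p []       h = refl
  ∑ₗ-filterᵇ p (x ∷ xs) h with p x
  ... | true  = cong₂ _+_ (sym (ℕP.+-identityʳ (h x))) (∑ₗ-filterᵇ p xs h)
  ... | false = ∑ₗ-filterᵇ p xs h

  ∑ₗ-map : ∀ (g : A → B) xs (h : B → ℕ) → ∑ₗ (map g xs) h ≡ ∑ₗ xs (h ∘ g)
  ∑ₗ-map g []       h = refl
  ∑ₗ-map g (x ∷ xs) h = cong (h (g x) +_) (∑ₗ-map g xs h)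

  ∑ₗ-concatMap : ∀ (g : A → List B) xs (h : B → ℕ) → ∑ₗ (concatMap g xs) h ≡ ∑ₗ xs (λ x → ∑ₗ (g x) h)
  ∑ₗ-concatMap g []       h = refl
  ∑ₗ-concatMap g (x ∷ xs) h = trans (∑ₗ-++ (g x) _ h) (cong (∑ₗ (g x) h +_) (∑ₗ-concatMap g xs h))

  ∑ₗ-tabulate : ∀ n (g : Fin n → A) (h : A → ℕ) → ∑ₗ (tabulate g) h ≡ sum (h ∘ g)
  ∑ₗ-tabulate zero    g h = refl
  ∑ₗ-tabulate (suc n) g h = cong (h (g zero) +_) (∑ₗ-tabulate n (g ∘ suc) h)

  ∑ₗ-applyUpTo : ∀ n (g : ℕ → A) (h : A → ℕ) → ∑ₗ (applyUpTo g n) h ≡ ∑ n (h ∘ g)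
  ∑ₗ-applyUpTo zero    g h = refl
  ∑ₗ-applyUpTo (suc n) g h = trans (cong (h (g 0) +_) (∑ₗ-applyUpTo n (g ∘ suc) h)) (sym (∑-head n (h ∘ g)))

  ∑ᵥ : (n L : ℕ) → (Vec (Fin n) L → ℕ) → ℕ
  ∑ᵥ n L h = ∑ₗ (allVecs n L) h

  ∑ᵥ-cong : ∀ n L {h g : Vec (Fin n) L → ℕ} → (∀ v → h v ≡ g v) → ∑ᵥ n L h ≡ ∑ᵥ n L g
  ∑ᵥ-cong n L = ∑ₗ-cong (allVecs n L)

  ∑ᵥ-[] : ∀ n (h : Vec (Fin n) 0 → ℕ) → ∑ᵥ n 0 h ≡ h []
  ∑ᵥ-[] n h = ℕP.+-identityʳ (h [])

  ∑ᵥ-∷ : ∀ n L (h : Vec (Fin n) (suc L) → ℕ) → ∑ᵥ n (suc L) h ≡ ∑ᵥ n L (λ v → sum (λ a → h (a ∷ v)))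
  ∑ᵥ-∷ n L h = trans (∑ₗ-concatMap _ (allVecs n L) h) (∑ᵥ-cong n L λ v →
    trans (∑ₗ-map (_∷ v) (allFin n) h) (∑ₗ-tabulate n (λ a → a) (h ∘ (_∷ v))))

  ∑ᵥ-++ : ∀ n k j (h : Vec (Fin n) (k + j) → ℕ) → ∑ᵥ n (k + j) h ≡ ∑ᵥ n j (λ v → ∑ᵥ n k (λ w → h (w ++ v)))
  ∑ᵥ-++ n zero    j h = ∑ᵥ-cong n j λ v → sym (∑ᵥ-[] n (λ w → h (w ++ v)))
  ∑ᵥ-++ n (suc k) j h = begin
    ∑ᵥ n (suc k + j) h                                          ≡⟨ ∑ᵥ-∷ n (k + j) h ⟩
    ∑ᵥ n (k + j) (λ u → sum (λ a → h (a ∷ u)))                  ≡⟨ ∑ᵥ-++ n k j _ ⟩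
    ∑ᵥ n j (λ v → ∑ᵥ n k (λ w → sum (λ a → h (a ∷ w ++ v))))    ≡⟨ ∑ᵥ-cong n j (λ v → ∑ᵥ-∷ n k _) ⟨
    ∑ᵥ n j (λ v → ∑ᵥ n (suc k) (λ w → h (w ++ v)))              ∎

  ∑ᵥ-∑-swap : ∀ n L m (h : Vec (Fin n) L → ℕ → ℕ) →
              ∑ᵥ n L (λ v → ∑ m (h v)) ≡ ∑ m (λ i → ∑ᵥ n L (λ v → h v i))
  ∑ᵥ-∑-swap n L zero    h = ∑ₗ-zero (allVecs n L)
  ∑ᵥ-∑-swap n L (suc m) h = trans (∑ₗ-+ (allVecs n L) _ _) (cong (_+ ∑ᵥ n L (λ v → h v m)) (∑ᵥ-∑-swap n L m h))

  _∈ᵇ_ : ∀ {n L} → Fin n → Vec (Fin n) L → Bool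
  a ∈ᵇ []      = false
  a ∈ᵇ (b ∷ v) = (toℕ a ≡ᵇ toℕ b) ∨ a ∈ᵇ v

  ∈ᵇ-sound : ∀ {n L} (a : Fin n) (v : Vec (Fin n) L) → T (a ∈ᵇ v) → Σ[ i ∈ Fin L ] lookup v i ≡ a
  ∈ᵇ-sound a (b ∷ v) t with Equivalence.to (T-∨ {toℕ a ≡ᵇ toℕ b}) t
  ... | inj₁ a≡b = zero , sym (FinP.toℕ-injective (ℕP.≡ᵇ⇒≡ _ _ a≡b))
  ... | inj₂ a∈v = let i , vi≡a = ∈ᵇ-sound a v a∈v in suc i , vi≡a

  ∈ᵇ-complete : ∀ {n L} (a : Fin n) (v : Vec (Fin n) L) i → lookup v i ≡ a → T (a ∈ᵇ v)
  ∈ᵇ-complete a (b ∷ v) zero    b≡a  = Equivalence.from T-∨ (inj₁ (ℕP.≡⇒≡ᵇ _ _ (cong toℕ (sym b≡a))))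
  ∈ᵇ-complete a (b ∷ v) (suc i) vi≡a = Equivalence.from (T-∨ {toℕ a ≡ᵇ toℕ b}) (inj₂ (∈ᵇ-complete a v i vi≡a))

  LookupInjective-∷⁻ : ∀ {n L} (a : Fin n) (v : Vec (Fin n) L) → LookupInjective (a ∷ v) → ¬ T (a ∈ᵇ v) × LookupInjective v
  LookupInjective-∷⁻ a v inj = (λ a∈v → let i , vi≡a = ∈ᵇ-sound a v a∈v in zero≢suc (inj (sym vi≡a)))
                             , λ vi≡vj → FinP.suc-injective (inj vi≡vj)
    where
    zero≢suc : ∀ {L} {i : Fin L} → Fin.zero ≢ suc i
    zero≢suc ()

  LookupInjective-∷⁺ : ∀ {n L} (a : Fin n) (v : Vec (Fin n) L) → ¬ T (a ∈ᵇ v) → LookupInjective v → LookupInjective (a ∷ v)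
  LookupInjective-∷⁺ a v a∉v inj {zero}  {zero}  _    = refl
  LookupInjective-∷⁺ a v a∉v inj {zero}  {suc j} a≡vj = ⊥-elim (a∉v (∈ᵇ-complete a v j (sym a≡vj)))
  LookupInjective-∷⁺ a v a∉v inj {suc i} {zero}  vi≡a = ⊥-elim (a∉v (∈ᵇ-complete a v i vi≡a))
  LookupInjective-∷⁺ a v a∉v inj {suc i} {suc j} vi≡vj = cong suc (inj vi≡vj)

  injectiveᵇ-∷ : ∀ {n L} (a : Fin n) (v : Vec (Fin n) L) → injectiveᵇ (a ∷ v) ≡ injectiveᵇ v ∧ not (a ∈ᵇ v)
  injectiveᵇ-∷ a v = T-ext
    (λ t → let a∉v , inj = LookupInjective-∷⁻ a v (injectiveᵇ-sound (a ∷ v) t)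
           in Equivalence.from T-∧ (injectiveᵇ-complete v inj , T-not⁺ a∉v))
    (λ t → let inj , a∉v = Equivalence.to (T-∧ {injectiveᵇ v}) t
           in injectiveᵇ-complete (a ∷ v) (LookupInjective-∷⁺ a v (T-not⁻ a∉v) (injectiveᵇ-sound v inj)))

  sum-χ≡ᵇ : ∀ {n} (b : Fin n) → sum {n} (λ a → χ (toℕ a ≡ᵇ toℕ b)) ≡ 1
  sum-χ≡ᵇ {suc n} zero    = cong suc (sum-replicate-zero n)
  sum-χ≡ᵇ {suc n} (suc b) = sum-χ≡ᵇ b

  sum-χ∈ᵇ : ∀ {n L} (v : Vec (Fin n) L) → LookupInjective v → sum {n} (λ a → χ (a ∈ᵇ v)) ≡ L
  sum-χ∈ᵇ {n} []      _   = sum-replicate-zero n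
  sum-χ∈ᵇ {n} (b ∷ v) inj = begin
    sum (λ a → χ ((toℕ a ≡ᵇ toℕ b) ∨ a ∈ᵇ v))
      ≡⟨ sum-cong-≗ (λ a → χ-∨ (toℕ a ≡ᵇ toℕ b) (a ∈ᵇ v) (disjoint a)) ⟩
    sum {n} (λ a → χ (toℕ a ≡ᵇ toℕ b) + χ (a ∈ᵇ v))
      ≡⟨ ∑-distrib-+ {n} (λ a → χ (toℕ a ≡ᵇ toℕ b)) (λ a → χ (a ∈ᵇ v)) ⟩
    sum {n} (λ a → χ (toℕ a ≡ᵇ toℕ b)) + sum (λ a → χ (a ∈ᵇ v))
      ≡⟨ cong₂ _+_ (sum-χ≡ᵇ b) (sum-χ∈ᵇ v (proj₂ b∉v×inj)) ⟩
    suc _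
      ∎
    where
    b∉v×inj = LookupInjective-∷⁻ b v inj
    disjoint : ∀ a → ¬ (T (toℕ a ≡ᵇ toℕ b) × T (a ∈ᵇ v))
    disjoint a (a≡b , a∈v) = proj₁ b∉v×inj (subst (λ c → T (c ∈ᵇ v)) (FinP.toℕ-injective (ℕP.≡ᵇ⇒≡ _ _ a≡b)) a∈v)

  sum-χ∉ᵇ : ∀ {n L} (v : Vec (Fin n) L) → LookupInjective v → sum {n} (λ a → χ (not (a ∈ᵇ v))) ≡ n ∸ L
  sum-χ∉ᵇ {n} {L} v inj = begin
    outside              ≡⟨ ℕP.m+n∸n≡m outside L ⟨
    outside + L ∸ L      ≡⟨ cong (λ c → outside + c ∸ L) (sum-χ∈ᵇ v inj) ⟨
    outside + inside ∸ L ≡⟨ cong (_∸ L) complementary ⟩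
    n ∸ L                ∎
    where
    outside = sum {n} (λ a → χ (not (a ∈ᵇ v)))
    inside  = sum {n} (λ a → χ (a ∈ᵇ v))
    sum-ones : ∀ n → sum {n} (λ _ → 1) ≡ n
    sum-ones zero    = refl
    sum-ones (suc n) = cong suc (sum-ones n)
    complementary : outside + inside ≡ n
    complementary = trans (sym (∑-distrib-+ (λ a → χ (not (a ∈ᵇ v))) (λ a → χ (a ∈ᵇ v))))
                          (trans (sum-cong-≗ (χ-not ∘ (_∈ᵇ v))) (sum-ones n))

  sum-injective-∷ : ∀ {n L} (v : Vec (Fin n) L) → sum {n} (λ a → χ (injectiveᵇ (a ∷ v))) ≡ χ (injectiveᵇ v) * (n ∸ L)
  sum-injective-∷ {n} {L} v = begin
    sum (λ a → χ (injectiveᵇ (a ∷ v)))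
      ≡⟨ sum-cong-≗ (λ a → trans (cong χ (injectiveᵇ-∷ a v)) (χ-∧ (injectiveᵇ v) (not (a ∈ᵇ v)))) ⟩
    sum (λ a → χ (injectiveᵇ v) * χ (not (a ∈ᵇ v)))
      ≡⟨ *-distribˡ-sum (χ (injectiveᵇ v)) (λ a → χ (not (a ∈ᵇ v))) ⟨
    χ (injectiveᵇ v) * sum (λ a → χ (not (a ∈ᵇ v)))
      ≡⟨ extensions ⟩
    χ (injectiveᵇ v) * (n ∸ L)
      ∎
    where
    extensions : χ (injectiveᵇ v) * sum (λ a → χ (not (a ∈ᵇ v))) ≡ χ (injectiveᵇ v) * (n ∸ L)
    extensions with injectiveᵇ v in eq
    ... | false = refl
    ... | true  = cong (1 *_) (sum-χ∉ᵇ v (injectiveᵇ-sound v (subst T (sym eq) _)))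

  ∑ᵥ-injectiveᵇ : ∀ n L → ∑ᵥ n L (χ ∘ injectiveᵇ) ≡ fall n L
  ∑ᵥ-injectiveᵇ n zero    = refl
  ∑ᵥ-injectiveᵇ n (suc L) = begin
    ∑ᵥ n (suc L) (χ ∘ injectiveᵇ)                       ≡⟨ ∑ᵥ-∷ n L _ ⟩
    ∑ᵥ n L (λ v → sum (λ a → χ (injectiveᵇ (a ∷ v))))    ≡⟨ ∑ᵥ-cong n L sum-injective-∷ ⟩
    ∑ᵥ n L (λ v → χ (injectiveᵇ v) * (n ∸ L))           ≡⟨ ∑ᵥ-cong n L (λ v → ℕP.*-comm _ (n ∸ L)) ⟩
    ∑ᵥ n L (λ v → (n ∸ L) * χ (injectiveᵇ v))           ≡⟨ ∑ₗ-*ˡ (allVecs n L) (n ∸ L) _ ⟩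
    (n ∸ L) * ∑ᵥ n L (χ ∘ injectiveᵇ)                   ≡⟨ cong ((n ∸ L) *_) (∑ᵥ-injectiveᵇ n L) ⟩
    (n ∸ L) * fall n L                                  ∎

  length-perms : ∀ n → length (perms n) ≡ n !
  length-perms n = trans (length-filterᵇ injectiveᵇ (allVecs n n)) (trans (∑ᵥ-injectiveᵇ n n) (fall-n-n n))

module Gluing where

  open Permutations
  open Data.Nat using (_+_; _*_; _≤_; _<_; _<ᵇ_; _≤ᵇ_)
  open Fin using (Fin; zero; suc; toℕ; _↑ˡ_; _↑ʳ_; splitAt; join; fromℕ<)
  open Vec using (Vec; []; _∷_; lookup; _++_)
  open import Algebra.Properties.Semiring.Sum ℕP.+-*-semiring using (sum; sum-cong-≗; *-distribˡ-sum; sum-replicate-zero)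
  open import Algebra.Properties.CommutativeSemigroup ℕP.*-commutativeSemigroup using () renaming (xy∙z≈y∙xz to *-rearrange)
  open ≡-Reasoning

  ↑-elim : ∀ k j {P : Fin (k + j) → Set} → (∀ i → P (i ↑ˡ j)) → (∀ i → P (k ↑ʳ i)) → ∀ i → P i
  ↑-elim k j {P} left right i = subst P (FinP.join-splitAt k j i) (by-side (splitAt k i))
    where
    by-side : ∀ s → P (join k j s)
    by-side (inj₁ a) = left a
    by-side (inj₂ b) = right b

  toℕ-↑ˡ< : ∀ {k} j (a : Fin k) → toℕ (a ↑ˡ j) < k
  toℕ-↑ˡ< j a = subst (_< _) (sym (FinP.toℕ-↑ˡ a j)) (FinP.toℕ<n a)

  toℕ-↑ʳ≥ : ∀ k {j} (b : Fin j) → k ≤ toℕ (k ↑ʳ b)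
  toℕ-↑ʳ≥ k b = subst (k ≤_) (sym (FinP.toℕ-↑ʳ k b)) (ℕP.m≤m+n k (toℕ b))

  ↑ˡ≢↑ʳ : ∀ {k j} (a : Fin k) (b : Fin j) → a ↑ˡ j ≢ k ↑ʳ b
  ↑ˡ≢↑ʳ {k} {j} a b eq = ℕP.<⇒≱ (toℕ-↑ˡ< j a) (subst (k ≤_) (sym (cong toℕ eq)) (toℕ-↑ʳ≥ k b))

  sum-↑ : ∀ k j (g : Fin (k + j) → ℕ) → sum {k + j} g ≡ sum {k} (g ∘ (_↑ˡ j)) + sum {j} (g ∘ (k ↑ʳ_))
  sum-↑ zero    j g = refl
  sum-↑ (suc k) j g = trans (cong (g zero +_) (sum-↑ k j (g ∘ suc))) (sym (ℕP.+-assoc (g zero) _ _))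

  glue : ∀ {k j} → Vec (Fin k) k → Vec (Fin j) j → Vec (Fin (k + j)) (k + j)
  glue {k} {j} w v = Vec.map (_↑ˡ j) w ++ Vec.map (k ↑ʳ_) v

  module _ {k j} (w : Vec (Fin k) k) (v : Vec (Fin j) j) where

    lookup-glue-↑ˡ : ∀ i → lookup (glue w v) (i ↑ˡ j) ≡ lookup w i ↑ˡ j
    lookup-glue-↑ˡ i = trans (VecP.lookup-++ˡ (Vec.map (_↑ˡ j) w) _ i) (VecP.lookup-map i (_↑ˡ j) w)

    lookup-glue-↑ʳ : ∀ i → lookup (glue w v) (k ↑ʳ i) ≡ k ↑ʳ lookup v i
    lookup-glue-↑ʳ i = trans (VecP.lookup-++ʳ (Vec.map (_↑ˡ j) w) _ i) (VecP.lookup-map i (k ↑ʳ_) v)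

    toℕ-lookup-glue-↑ˡ : ∀ i → toℕ (lookup (glue w v) (i ↑ˡ j)) ≡ toℕ (lookup w i)
    toℕ-lookup-glue-↑ˡ i = trans (cong toℕ (lookup-glue-↑ˡ i)) (FinP.toℕ-↑ˡ (lookup w i) j)

    toℕ-lookup-glue-↑ʳ : ∀ i → toℕ (lookup (glue w v) (k ↑ʳ i)) ≡ k + toℕ (lookup v i)
    toℕ-lookup-glue-↑ʳ i = trans (cong toℕ (lookup-glue-↑ʳ i)) (FinP.toℕ-↑ʳ k (lookup v i))

    LookupInjective-glue⁻ : LookupInjective (glue w v) → LookupInjective w × LookupInjective v
    LookupInjective-glue⁻ inj =
        (λ {a} {b} wa≡wb → FinP.↑ˡ-injective j a b
          (inj (trans (lookup-glue-↑ˡ a) (trans (cong (_↑ˡ j) wa≡wb) (sym (lookup-glue-↑ˡ b))))))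
      , (λ {a} {b} va≡vb → FinP.↑ʳ-injective k a b
          (inj (trans (lookup-glue-↑ʳ a) (trans (cong (k ↑ʳ_) va≡vb) (sym (lookup-glue-↑ʳ b))))))

    LookupInjective-glue⁺ : LookupInjective w → LookupInjective v → LookupInjective (glue w v)
    LookupInjective-glue⁺ injw injv {x} {y} = ↑-elim k j {λ x → ∀ y → lookup (glue w v) x ≡ lookup (glue w v) y → x ≡ y}
      (λ a → ↑-elim k j
        (λ b eq → cong (_↑ˡ j) (injw (FinP.↑ˡ-injective j _ _ (trans (sym (lookup-glue-↑ˡ a)) (trans eq (lookup-glue-↑ˡ b))))))
        (λ b eq → ⊥-elim (↑ˡ≢↑ʳ _ _ (trans (sym (lookup-glue-↑ˡ a)) (trans eq (lookup-glue-↑ʳ b))))))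
      (λ a → ↑-elim k j
        (λ b eq → ⊥-elim (↑ˡ≢↑ʳ _ _ (trans (sym (lookup-glue-↑ˡ b)) (trans (sym eq) (lookup-glue-↑ʳ a)))))
        (λ b eq → cong (k ↑ʳ_) (injv (FinP.↑ʳ-injective k _ _ (trans (sym (lookup-glue-↑ʳ a)) (trans eq (lookup-glue-↑ʳ b)))))))
      x y

    injectiveᵇ-glue : injectiveᵇ (glue w v) ≡ injectiveᵇ w ∧ injectiveᵇ v
    injectiveᵇ-glue = T-ext
      (λ t → let injw , injv = LookupInjective-glue⁻ (injectiveᵇ-sound (glue w v) t)
             in Equivalence.from T-∧ (injectiveᵇ-complete w injw , injectiveᵇ-complete v injv))
      (λ t → let tw , tv = Equivalence.to (T-∧ {injectiveᵇ w}) t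
             in injectiveᵇ-complete (glue w v) (LookupInjective-glue⁺ (injectiveᵇ-sound w tw) (injectiveᵇ-sound v tv)))

    isCutᵇ-glue-≤ : ∀ p → p ≤ k → isCutᵇ (glue w v) p ≡ isCutᵇ w p
    isCutᵇ-glue-≤ p p≤k = T-ext
      (λ t → isCutᵇ-complete w p λ i i<p → subst (_< p) (toℕ-lookup-glue-↑ˡ i)
        (isCutᵇ-sound (glue w v) p t (i ↑ˡ j) (subst (_< p) (sym (FinP.toℕ-↑ˡ i j)) i<p)))
      (λ t → isCutᵇ-complete (glue w v) p (↑-elim k j
        (λ i i<p → subst (_< p) (sym (toℕ-lookup-glue-↑ˡ i)) (isCutᵇ-sound w p t i (subst (_< p) (FinP.toℕ-↑ˡ i j) i<p)))
        (λ i i<p → contradiction (ℕP.≤-trans i<p p≤k) (ℕP.≤⇒≯ (toℕ-↑ʳ≥ k i)))))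

    isCutᵇ-glue-+ : ∀ q → isCutᵇ (glue w v) (k + q) ≡ isCutᵇ v q
    isCutᵇ-glue-+ q = T-ext
      (λ t → isCutᵇ-complete v q λ i i<q → ℕP.+-cancelˡ-< k _ _ (subst (_< k + q) (toℕ-lookup-glue-↑ʳ i)
        (isCutᵇ-sound (glue w v) (k + q) t (k ↑ʳ i) (subst (_< k + q) (sym (FinP.toℕ-↑ʳ k i)) (ℕP.+-monoʳ-< k i<q)))))
      (λ t → isCutᵇ-complete (glue w v) (k + q) (↑-elim k j
        (λ i _ → subst (_< k + q) (sym (toℕ-lookup-glue-↑ˡ i)) (ℕP.≤-trans (FinP.toℕ<n (lookup w i)) (ℕP.m≤m+n k q)))
        (λ i i<k+q → subst (_< k + q) (sym (toℕ-lookup-glue-↑ʳ i)) (ℕP.+-monoʳ-< k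
          (isCutᵇ-sound v q t i (ℕP.+-cancelˡ-< k _ _ (subst (_< k + q) (FinP.toℕ-↑ʳ k i) i<k+q)))))))

  allᵥ : ∀ {n L} → (Fin n → Bool) → Vec (Fin n) L → Bool
  allᵥ p []      = true
  allᵥ p (a ∷ w) = p a ∧ allᵥ p w

  allᵥ-sound : ∀ {n L} (p : Fin n → Bool) (w : Vec (Fin n) L) → T (allᵥ p w) → ∀ i → T (p (lookup w i))
  allᵥ-sound p (a ∷ w) t zero    = proj₁ (Equivalence.to T-∧ t)
  allᵥ-sound p (a ∷ w) t (suc i) = allᵥ-sound p w (proj₂ (Equivalence.to (T-∧ {p a}) t)) i

  allᵥ-complete : ∀ {n L} (p : Fin n → Bool) (w : Vec (Fin n) L) → (∀ i → T (p (lookup w i))) → T (allᵥ p w)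
  allᵥ-complete p []      _ = _
  allᵥ-complete p (a ∷ w) h = Equivalence.from T-∧ (h zero , allᵥ-complete p w (h ∘ suc))

  isLow isHigh : ∀ {n} → ℕ → Fin n → Bool
  isLow  k a = toℕ a <ᵇ k
  isHigh k a = k ≤ᵇ toℕ a

  module _ k {j} (w : Vec (Fin (k + j)) k) (v : Vec (Fin (k + j)) j) where

    isCutᵇ-++ : isCutᵇ (w ++ v) k ≡ allᵥ (isLow k) w
    isCutᵇ-++ = T-ext
      (λ t → allᵥ-complete (isLow k) w λ i → ℕP.<⇒<ᵇ (subst (_< k) (cong toℕ (VecP.lookup-++ˡ w v i))
        (isCutᵇ-sound (w ++ v) k t (i ↑ˡ j) (toℕ-↑ˡ< j i))))
      (λ t → isCutᵇ-complete (w ++ v) k (↑-elim k j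
        (λ i _ → subst (_< k) (sym (cong toℕ (VecP.lookup-++ˡ w v i))) (ℕP.<ᵇ⇒< _ _ (allᵥ-sound (isLow k) w t i)))
        (λ i i<k → contradiction i<k (ℕP.≤⇒≯ (toℕ-↑ʳ≥ k i)))))

    high-after-low : T (injectiveᵇ (w ++ v)) → T (allᵥ (isLow k) w) → T (allᵥ (isHigh k) v)
    high-after-low inj low = allᵥ-complete (isHigh k) v high
      where
      high : ∀ q → T (isHigh k (lookup v q))
      high q with k ℕP.≤? toℕ (lookup v q)
      ... | yes k≤vq = ℕP.≤⇒≤ᵇ k≤vq
      ... | no  k≰vq = ⊥-elim (FinP.<⇒notInjective (ℕP.n<1+n k) squeeze)
        where
        index : Fin (suc k) → Fin (k + j)
        index zero    = k ↑ʳ q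
        index (suc i) = i ↑ˡ j
        index-injective : Injective _≡_ _≡_ index
        index-injective {zero}  {zero}  _ = refl
        index-injective {zero}  {suc b} e = ⊥-elim (↑ˡ≢↑ʳ b q (sym e))
        index-injective {suc a} {zero}  e = ⊥-elim (↑ˡ≢↑ʳ a q e)
        index-injective {suc a} {suc b} e = cong suc (FinP.↑ˡ-injective j a b e)
        low-at : ∀ x → toℕ (lookup (w ++ v) (index x)) < k
        low-at zero    = subst (_< k) (sym (cong toℕ (VecP.lookup-++ʳ w v q))) (ℕP.≰⇒> k≰vq)
        low-at (suc i) = subst (_< k) (sym (cong toℕ (VecP.lookup-++ˡ w v i))) (ℕP.<ᵇ⇒< _ _ (allᵥ-sound (isLow k) w low i))
        squeeze : Injective _≡_ _≡_ (λ x → fromℕ< (low-at x))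
        squeeze {x} {y} eq = index-injective (injectiveᵇ-sound (w ++ v) inj (FinP.toℕ-injective
          (trans (sym (FinP.toℕ-fromℕ< (low-at x))) (trans (cong toℕ eq) (FinP.toℕ-fromℕ< (low-at y))))))

  ∑ᵥ-restrict : ∀ {m n} (e : Fin m → Fin n) (p : Fin n → Bool) →
    (∀ g → sum {n} (λ a → χ (p a) * g a) ≡ sum {m} (g ∘ e)) →
    ∀ L (h : Vec (Fin n) L → ℕ) → ∑ᵥ n L (λ w → χ (allᵥ p w) * h w) ≡ ∑ᵥ m L (h ∘ Vec.map e)
  ∑ᵥ-restrict {m} {n} e p restrict zero    h =
    trans (∑ᵥ-[] n (λ w → χ (allᵥ p w) * h w)) (trans (ℕP.*-identityˡ (h [])) (sym (∑ᵥ-[] m (h ∘ Vec.map e))))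
  ∑ᵥ-restrict {m} {n} e p restrict (suc L) h = begin
    ∑ᵥ n (suc L) (λ w → χ (allᵥ p w) * h w)
      ≡⟨ ∑ᵥ-∷ n L _ ⟩
    ∑ᵥ n L (λ w → sum {n} (λ a → χ (p a ∧ allᵥ p w) * h (a ∷ w)))
      ≡⟨ ∑ᵥ-cong n L (λ w → trans (sum-cong-≗ {n} (λ a → trans (cong (_* h (a ∷ w)) (χ-∧ (p a) (allᵥ p w)))
                                                            (*-rearrange (χ (p a)) (χ (allᵥ p w)) (h (a ∷ w)))))
                                   (sym (*-distribˡ-sum (χ (allᵥ p w)) (λ a → χ (p a) * h (a ∷ w))))) ⟩
    ∑ᵥ n L (λ w → χ (allᵥ p w) * sum {n} (λ a → χ (p a) * h (a ∷ w)))
      ≡⟨ ∑ᵥ-restrict e p restrict L _ ⟩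
    ∑ᵥ m L (λ w → sum {n} (λ a → χ (p a) * h (a ∷ Vec.map e w)))
      ≡⟨ ∑ᵥ-cong m L (λ w → restrict (λ a → h (a ∷ Vec.map e w))) ⟩
    ∑ᵥ m L (λ w → sum {m} (λ b → h (e b ∷ Vec.map e w)))
      ≡⟨ ∑ᵥ-∷ m L _ ⟨
    ∑ᵥ m (suc L) (h ∘ Vec.map e)
      ∎

  sum-χ-selects-left : ∀ k j (p : Fin (k + j) → Bool) → (∀ a → T (p (a ↑ˡ j))) → (∀ b → ¬ T (p (k ↑ʳ b))) →
    ∀ g → sum {k + j} (λ a → χ (p a) * g a) ≡ sum {k} (g ∘ (_↑ˡ j))
  sum-χ-selects-left k j p left right g = begin
    sum {k + j} (λ a → χ (p a) * g a)
      ≡⟨ sum-↑ k j _ ⟩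
    sum {k} (λ a → χ (p (a ↑ˡ j)) * g (a ↑ˡ j)) + sum {j} (λ b → χ (p (k ↑ʳ b)) * g (k ↑ʳ b))
      ≡⟨ cong₂ _+_ (sum-cong-≗ {k} (λ a → trans (cong (_* g (a ↑ˡ j)) (χ-T (left a))) (ℕP.*-identityˡ _)))
                   (trans (sum-cong-≗ {j} (λ b → cong (_* g (k ↑ʳ b)) (χ-¬T (right b)))) (sum-replicate-zero j)) ⟩
    sum {k} (g ∘ (_↑ˡ j)) + 0
      ≡⟨ ℕP.+-identityʳ _ ⟩
    sum {k} (g ∘ (_↑ˡ j))
      ∎

  sum-χ-selects-right : ∀ k j (p : Fin (k + j) → Bool) → (∀ a → ¬ T (p (a ↑ˡ j))) → (∀ b → T (p (k ↑ʳ b))) →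
    ∀ g → sum {k + j} (λ a → χ (p a) * g a) ≡ sum {j} (g ∘ (k ↑ʳ_))
  sum-χ-selects-right k j p left right g = begin
    sum {k + j} (λ a → χ (p a) * g a)
      ≡⟨ sum-↑ k j _ ⟩
    sum {k} (λ a → χ (p (a ↑ˡ j)) * g (a ↑ˡ j)) + sum {j} (λ b → χ (p (k ↑ʳ b)) * g (k ↑ʳ b))
      ≡⟨ cong₂ _+_ (trans (sum-cong-≗ {k} (λ a → cong (_* g (a ↑ˡ j)) (χ-¬T (left a)))) (sum-replicate-zero k))
                   (sum-cong-≗ {j} (λ b → trans (cong (_* g (k ↑ʳ b)) (χ-T (right b))) (ℕP.*-identityˡ _))) ⟩
    0 + sum {j} (g ∘ (k ↑ʳ_))
      ∎

  sum-χ-isLow : ∀ k j (g : Fin (k + j) → ℕ) → sum {k + j} (λ a → χ (isLow k a) * g a) ≡ sum {k} (g ∘ (_↑ˡ j))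
  sum-χ-isLow k j = sum-χ-selects-left k j (isLow k)
    (λ a → ℕP.<⇒<ᵇ (toℕ-↑ˡ< j a)) (λ b → ℕP.≤⇒≯ (toℕ-↑ʳ≥ k b) ∘ ℕP.<ᵇ⇒< _ _)

  sum-χ-isHigh : ∀ k j (g : Fin (k + j) → ℕ) → sum {k + j} (λ a → χ (isHigh k a) * g a) ≡ sum {j} (g ∘ (k ↑ʳ_))
  sum-χ-isHigh k j = sum-χ-selects-right k j (isHigh k)
    (λ a → ℕP.<⇒≱ (toℕ-↑ˡ< j a) ∘ ℕP.≤ᵇ⇒≤ _ _) (λ b → ℕP.≤⇒≤ᵇ (toℕ-↑ʳ≥ k b))

  ∑ₚ : (n : ℕ) → (Vec (Fin n) n → ℕ) → ℕ
  ∑ₚ n G = ∑ᵥ n n (λ σ → χ (injectiveᵇ σ) * G σ)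

  χ-insert-implied : ∀ c a b x → (T c → T a → T b) → χ c * (χ a * x) ≡ χ b * (χ a * (χ c * x))
  χ-insert-implied false a     b     x _ = sym (trans (cong (χ b *_) (ℕP.*-zeroʳ (χ a))) (ℕP.*-zeroʳ (χ b)))
  χ-insert-implied true  false b     x _ = sym (ℕP.*-zeroʳ (χ b))
  χ-insert-implied true  true  true  x _ = cong (λ y → 1 * (1 * y)) (sym (ℕP.*-identityˡ x))
  χ-insert-implied true  true  false x c⇒a⇒b = ⊥-elim (c⇒a⇒b _ _)

  -- σ = w ++ v has [k] as a cut iff all values of w lie below k; injectivity then puts all values
  -- of v at or above k, and restricting both halves to these ranges leaves exactly the glued pairs.
  ∑ₚ-cut : ∀ k j (G : Vec (Fin (k + j)) (k + j) → ℕ) →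
    ∑ₚ (k + j) (λ σ → χ (isCutᵇ σ k) * G σ) ≡ ∑ₚ j (λ v → ∑ₚ k (λ w → G (glue w v)))
  ∑ₚ-cut k j G = begin
    ∑ᵥ N N (λ σ → χ (injectiveᵇ σ) * (χ (isCutᵇ σ k) * G σ))
      ≡⟨ ∑ᵥ-++ N k j _ ⟩
    ∑ᵥ N j (λ v → ∑ᵥ N k (λ w → χ (injectiveᵇ (w ++ v)) * (χ (isCutᵇ (w ++ v) k) * G (w ++ v))))
      ≡⟨ ∑ᵥ-cong N j (λ v → ∑ᵥ-cong N k (λ w →
           trans (cong (λ c → χ (injectiveᵇ (w ++ v)) * (χ c * G (w ++ v))) (isCutᵇ-++ k w v))
                 (χ-insert-implied (injectiveᵇ (w ++ v)) (allᵥ (isLow k) w) (allᵥ (isHigh k) v) _ (high-after-low k w v)))) ⟩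
    ∑ᵥ N j (λ v → ∑ᵥ N k (λ w → χ (allᵥ (isHigh k) v) * (χ (allᵥ (isLow k) w) * H w v)))
      ≡⟨ ∑ᵥ-cong N j (λ v → ∑ₗ-*ˡ (allVecs N k) (χ (allᵥ (isHigh k) v)) _) ⟩
    ∑ᵥ N j (λ v → χ (allᵥ (isHigh k) v) * ∑ᵥ N k (λ w → χ (allᵥ (isLow k) w) * H w v))
      ≡⟨ ∑ᵥ-cong N j (λ v → cong (χ (allᵥ (isHigh k) v) *_) (∑ᵥ-restrict (_↑ˡ j) (isLow k) (sum-χ-isLow k j) k _)) ⟩
    ∑ᵥ N j (λ v → χ (allᵥ (isHigh k) v) * ∑ᵥ k k (λ w → H (Vec.map (_↑ˡ j) w) v))
      ≡⟨ ∑ᵥ-restrict (k ↑ʳ_) (isHigh k) (sum-χ-isHigh k j) j _ ⟩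
    ∑ᵥ j j (λ v → ∑ᵥ k k (λ w → χ (injectiveᵇ (glue w v)) * G (glue w v)))
      ≡⟨ ∑ᵥ-cong j j (λ v → trans (∑ᵥ-cong k k (λ w → separate w v)) (∑ₗ-*ˡ (allVecs k k) (χ (injectiveᵇ v)) _)) ⟩
    ∑ᵥ j j (λ v → χ (injectiveᵇ v) * ∑ᵥ k k (λ w → χ (injectiveᵇ w) * G (glue w v)))
      ∎
    where
    N = k + j
    H : Vec (Fin N) k → Vec (Fin N) j → ℕ
    H w v = χ (injectiveᵇ (w ++ v)) * G (w ++ v)
    separate : ∀ w v → χ (injectiveᵇ (glue w v)) * G (glue w v) ≡ χ (injectiveᵇ v) * (χ (injectiveᵇ w) * G (glue w v))
    separate w v = begin
      χ (injectiveᵇ (glue w v)) * G (glue w v)                ≡⟨ cong (λ b → χ b * G (glue w v)) (injectiveᵇ-glue w v) ⟩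
      χ (injectiveᵇ w ∧ injectiveᵇ v) * G (glue w v)          ≡⟨ cong (_* G (glue w v)) (χ-∧ (injectiveᵇ w) (injectiveᵇ v)) ⟩
      χ (injectiveᵇ w) * χ (injectiveᵇ v) * G (glue w v)      ≡⟨ *-rearrange (χ (injectiveᵇ w)) _ _ ⟩
      χ (injectiveᵇ v) * (χ (injectiveᵇ w) * G (glue w v))    ∎

module Parts where

  open Factorials using (fall-n-n)
  open Permutations
  open Gluing
  open Data.Nat using (_+_; _*_; _≤_; _≡ᵇ_; _<ᵇ_; _!; s≤s; s≤s⁻¹)
  open Fin using (Fin)
  open List using (applyUpTo)
  open Vec using (Vec; lookup)
  open import Relation.Nullary.Decidable using (T?)
  open ≡-Reasoning
  open Sumℕ

  cuts : ∀ {n} → Vec (Fin n) n → ℕ → ℕ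
  cuts σ p = ∑ p (λ q → χ (isCutᵇ σ (suc q)))

  numParts≡cuts : ∀ {n} (σ : Vec (Fin n) n) → numParts σ ≡ cuts σ n
  numParts≡cuts {n} σ = trans (length-filterᵇ (isCutᵇ σ) (applyUpTo suc n)) (∑ₗ-applyUpTo n suc (χ ∘ isCutᵇ σ))

  isCutᵇ-0 : ∀ {n} (σ : Vec (Fin n) n) → isCutᵇ σ 0 ≡ true
  isCutᵇ-0 σ = T-ext _ (λ _ → isCutᵇ-complete σ 0 (λ _ ()))

  isCutᵇ-n : ∀ {n} (σ : Vec (Fin n) n) → isCutᵇ σ n ≡ true
  isCutᵇ-n σ = T-ext _ (λ _ → isCutᵇ-complete σ _ (λ i _ → FinP.toℕ<n (lookup σ i)))

  -- A sum over the marked points k ≤ N, 0 being marked, reindexed by the rank of k among them.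
  ∑-marked-by-rank : ∀ (c : ℕ → Bool) → c 0 ≡ true → ∀ (F : ℕ → ℕ) N →
    ∑ (suc N) (λ k → χ (c k) * F (∑ k (χ ∘ c ∘ suc))) ≡ ∑ (suc (∑ N (χ ∘ c ∘ suc))) F
  ∑-marked-by-rank c c0 F zero    rewrite c0 = cong (0 +_) (ℕP.+-identityʳ (F 0))
  ∑-marked-by-rank c c0 F (suc N) =
    trans (cong (_+ χ (c (suc N)) * F (∑ (suc N) (χ ∘ c ∘ suc))) (∑-marked-by-rank c c0 F N))
          (step (∑ N (χ ∘ c ∘ suc)) (c (suc N)))
    where
    step : ∀ r b → ∑ (suc r) F + χ b * F (r + χ b) ≡ ∑ (suc (r + χ b)) F
    step r true  rewrite ℕP.+-comm r 1 = cong (∑ (suc r) F +_) (ℕP.+-identityʳ _)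
    step r false rewrite ℕP.+-identityʳ r = ℕP.+-identityʳ _

  module _ {k j} (w : Vec (Fin k) k) (v : Vec (Fin j) j) where

    cuts-glue-left : cuts (glue w v) k ≡ numParts w
    cuts-glue-left = trans (∑-cong k (λ q q<k → cong χ (isCutᵇ-glue-≤ w v (suc q) q<k))) (sym (numParts≡cuts w))

    cuts-glue-all : cuts (glue w v) (k + j) ≡ numParts w + numParts v
    cuts-glue-all = trans (∑-split k j _) (cong₂ _+_ cuts-glue-left
      (trans (∑-cong j (λ q _ → trans (cong (χ ∘ isCutᵇ (glue w v)) (sym (ℕP.+-suc k q))) (cong χ (isCutᵇ-glue-+ w v (suc q)))))
             (sym (numParts≡cuts v))))

  byParts : (ℕ → ℕ) → ℕ → ℕ
  byParts A n = ∑ₚ n (λ σ → A (numParts σ))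

  ∑ₚ-cut-parts : ∀ (A B : ℕ → ℕ) k j →
    ∑ₚ (k + j) (λ σ → χ (isCutᵇ σ k) * (A (cuts σ k) * B (cuts σ (k + j) ∸ cuts σ k))) ≡ byParts A k * byParts B j
  ∑ₚ-cut-parts A B k j = begin
    ∑ₚ (k + j) (λ σ → χ (isCutᵇ σ k) * (A (cuts σ k) * B (cuts σ (k + j) ∸ cuts σ k)))
      ≡⟨ ∑ₚ-cut k j _ ⟩
    ∑ₚ j (λ v → ∑ₚ k (λ w → A (cuts (glue w v) k) * B (cuts (glue w v) (k + j) ∸ cuts (glue w v) k)))
      ≡⟨ ∑ᵥ-cong j j (λ v → cong (χ (injectiveᵇ v) *_) (∑ᵥ-cong k k (λ w → cong (χ (injectiveᵇ w) *_) (parts w v)))) ⟩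
    ∑ₚ j (λ v → ∑ₚ k (λ w → A (numParts w) * B (numParts v)))
      ≡⟨ ∑ᵥ-cong j j (λ v → cong (χ (injectiveᵇ v) *_) (∑ᵥ-cong k k (λ w → sym (ℕP.*-assoc (χ (injectiveᵇ w)) _ _)))) ⟩
    ∑ₚ j (λ v → ∑ᵥ k k (λ w → χ (injectiveᵇ w) * A (numParts w) * B (numParts v)))
      ≡⟨ ∑ᵥ-cong j j (λ v → cong (χ (injectiveᵇ v) *_) (∑ₗ-*ʳ (allVecs k k) (B (numParts v)) _)) ⟩
    ∑ₚ j (λ v → byParts A k * B (numParts v))
      ≡⟨ ∑ᵥ-cong j j (λ v → x∙yz≈y∙xz (χ (injectiveᵇ v)) (byParts A k) _) ⟩
    ∑ᵥ j j (λ v → byParts A k * (χ (injectiveᵇ v) * B (numParts v)))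
      ≡⟨ ∑ₗ-*ˡ (allVecs j j) (byParts A k) _ ⟩
    byParts A k * byParts B j
      ∎
    where
    open import Algebra.Properties.CommutativeSemigroup ℕP.*-commutativeSemigroup using (x∙yz≈y∙xz)
    parts : ∀ w v → A (cuts (glue w v) k) * B (cuts (glue w v) (k + j) ∸ cuts (glue w v) k) ≡ A (numParts w) * B (numParts v)
    parts w v = cong₂ _*_ (cong A (cuts-glue-left w v))
      (cong B (trans (cong₂ _∸_ (cuts-glue-all w v) (cuts-glue-left w v)) (ℕP.m+n∸m≡n (numParts w) (numParts v))))

  byParts-⋆ : ∀ (A B : ℕ → ℕ) N → (byParts A ⋆ byParts B) N ≡ byParts (A ⋆ B) N
  byParts-⋆ A B N = sym (begin
    ∑ₚ N (λ σ → (A ⋆ B) (numParts σ))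
      ≡⟨ ∑ᵥ-cong N N (λ σ → cong (χ (injectiveᵇ σ) *_) (by-cut-points σ)) ⟩
    ∑ᵥ N N (λ σ → χ (injectiveᵇ σ) * ∑ (suc N) (λ k → term σ k))
      ≡⟨ ∑ᵥ-cong N N (λ σ → sym (∑-*ˡ (suc N) (χ (injectiveᵇ σ)) (term σ))) ⟩
    ∑ᵥ N N (λ σ → ∑ (suc N) (λ k → χ (injectiveᵇ σ) * term σ k))
      ≡⟨ ∑ᵥ-∑-swap N N (suc N) _ ⟩
    ∑ (suc N) (λ k → ∑ₚ N (λ σ → term σ k))
      ≡⟨ ∑-cong (suc N) (λ k k≤N → split-at k (N ∸ k) (ℕP.m+[n∸m]≡n (s≤s⁻¹ k≤N))) ⟩
    ∑ (suc N) (λ k → byParts A k * byParts B (N ∸ k))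
      ∎)
    where
    term : Vec (Fin N) N → ℕ → ℕ
    term σ k = χ (isCutᵇ σ k) * (A (cuts σ k) * B (cuts σ N ∸ cuts σ k))
    by-cut-points : ∀ σ → (A ⋆ B) (numParts σ) ≡ ∑ (suc N) (term σ)
    by-cut-points σ = trans (cong (λ p → (A ⋆ B) p) (numParts≡cuts σ))
      (sym (∑-marked-by-rank (isCutᵇ σ) (isCutᵇ-0 σ) (λ a → A a * B (cuts σ N ∸ a)) N))
    split-at : ∀ k j → k + j ≡ N → ∑ₚ N (λ σ → term σ k) ≡ byParts A k * byParts B j
    split-at k j refl = ∑ₚ-cut-parts A B k j

  byParts-cong : ∀ {A B : ℕ → ℕ} → (∀ p → A p ≡ B p) → ∀ n → byParts A n ≡ byParts B n
  byParts-cong A≡B n = ∑ᵥ-cong n n (λ σ → cong (χ (injectiveᵇ σ) *_) (A≡B (numParts σ)))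

  byParts-+ : ∀ (A B : ℕ → ℕ) n → byParts A n + byParts B n ≡ byParts (λ p → A p + B p) n
  byParts-+ A B n = trans (sym (∑ₗ-+ (allVecs n n) _ _))
    (∑ᵥ-cong n n (λ σ → sym (ℕP.*-distribˡ-+ (χ (injectiveᵇ σ)) (A (numParts σ)) _)))

  byParts-∑ : ∀ m (A : ℕ → ℕ → ℕ) n → ∑ m (λ q → byParts (A q) n) ≡ byParts (λ p → ∑ m (λ q → A q p)) n
  byParts-∑ m A n = trans (sym (∑ᵥ-∑-swap n n m _))
    (∑ᵥ-cong n n (λ σ → ∑-*ˡ m (χ (injectiveᵇ σ)) (λ q → A q (numParts σ))))

  ip-byParts : ∀ k m → ip k m ≡ byParts (λ p → χ (p ≡ᵇ m)) k
  ip-byParts k m = trans (length-filterᵇ _ (perms k)) (∑ₗ-filterᵇ injectiveᵇ (allVecs k k) _)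

  factorial-byParts : ∀ k → byParts (λ _ → 1) k ≡ k !
  factorial-byParts k = trans (∑ᵥ-cong k k (λ σ → ℕP.*-identityʳ _)) (trans (∑ᵥ-injectiveᵇ k k) (fall-n-n k))

  ≡ᵇ-comm : ∀ m n → (m ≡ᵇ n) ≡ (n ≡ᵇ m)
  ≡ᵇ-comm zero    zero    = refl
  ≡ᵇ-comm zero    (suc n) = refl
  ≡ᵇ-comm (suc m) zero    = refl
  ≡ᵇ-comm (suc m) (suc n) = ≡ᵇ-comm m n

  ∑-χ≡ᵇ : ∀ n a (g : ℕ → ℕ) → ∑ n (λ i → χ (i ≡ᵇ a) * g i) ≡ χ (a <ᵇ n) * g a
  ∑-χ≡ᵇ zero    a g = refl
  ∑-χ≡ᵇ (suc n) a g = trans (cong (_+ χ (n ≡ᵇ a) * g n) (∑-χ≡ᵇ n a g)) (step a n g)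
    where
    step : ∀ a n (g : ℕ → ℕ) → χ (a <ᵇ n) * g a + χ (n ≡ᵇ a) * g n ≡ χ (a <ᵇ suc n) * g a
    step zero    zero    g = refl
    step zero    (suc n) g = ℕP.+-identityʳ _
    step (suc a) zero    g = refl
    step (suc a) (suc n) g = step a n (g ∘ suc)

  χ-<ᵇ-complement : ∀ b p → χ (b <ᵇ suc p) + χ (p <ᵇ b) ≡ 1
  χ-<ᵇ-complement zero    p       = refl
  χ-<ᵇ-complement (suc b) zero    = refl
  χ-<ᵇ-complement (suc b) (suc p) = χ-<ᵇ-complement b p

  ⋆-χ≡ᵇ : ∀ (A : ℕ → ℕ) b p → (A ⋆ (λ q → χ (q ≡ᵇ b))) p ≡ χ (b <ᵇ suc p) * A (p ∸ b)
  ⋆-χ≡ᵇ A b p = trans (⋆-comm A (λ q → χ (q ≡ᵇ b)) p) (∑-χ≡ᵇ (suc p) b (λ i → A (p ∸ i)))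

  χ≡ᵇ-⋆-χ≡ᵇ : ∀ a b p → ((λ q → χ (q ≡ᵇ a)) ⋆ (λ q → χ (q ≡ᵇ b))) p ≡ χ (p ≡ᵇ a + b)
  χ≡ᵇ-⋆-χ≡ᵇ a b p =
    trans (⋆-χ≡ᵇ (λ q → χ (q ≡ᵇ a)) b p) (trans (sym (χ-∧ (b <ᵇ suc p) (p ∸ b ≡ᵇ a))) (cong χ (T-ext to from)))
    where
    to : T ((b <ᵇ suc p) ∧ (p ∸ b ≡ᵇ a)) → T (p ≡ᵇ a + b)
    to t = let b≤p , p∸b≡a = Equivalence.to (T-∧ {b <ᵇ suc p}) t in ℕP.≡⇒≡ᵇ p (a + b)
      (trans (sym (ℕP.m∸n+n≡m (s≤s⁻¹ (ℕP.<ᵇ⇒< b (suc p) b≤p)))) (cong (_+ b) (ℕP.≡ᵇ⇒≡ (p ∸ b) a p∸b≡a)))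
    from : T (p ≡ᵇ a + b) → T ((b <ᵇ suc p) ∧ (p ∸ b ≡ᵇ a))
    from t with ℕP.≡ᵇ⇒≡ p (a + b) t
    ... | refl = Equivalence.from T-∧ (ℕP.<⇒<ᵇ (s≤s (ℕP.m≤n+m b a)) , ℕP.≡⇒≡ᵇ (a + b ∸ b) a (ℕP.m+n∸n≡m a b))

  ip-⋆ : ∀ a b N → ((λ k → ip k a) ⋆ (λ k → ip k b)) N ≡ ip N (a + b)
  ip-⋆ a b N = begin
    ((λ k → ip k a) ⋆ (λ k → ip k b)) N
      ≡⟨ ⋆-cong (λ k → ip-byParts k a) (λ k → ip-byParts k b) N ⟩
    (byParts (λ p → χ (p ≡ᵇ a)) ⋆ byParts (λ p → χ (p ≡ᵇ b))) N
      ≡⟨ byParts-⋆ (λ p → χ (p ≡ᵇ a)) (λ p → χ (p ≡ᵇ b)) N ⟩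
    byParts ((λ p → χ (p ≡ᵇ a)) ⋆ (λ p → χ (p ≡ᵇ b))) N
      ≡⟨ byParts-cong (χ≡ᵇ-⋆-χ≡ᵇ a b) N ⟩
    byParts (λ p → χ (p ≡ᵇ a + b)) N
      ≡⟨ ip-byParts N (a + b) ⟨
    ip N (a + b)
      ∎

  factorial-⋆-ip : ∀ b N → (_! ⋆ (λ k → ip k b)) N + ∑ b (ip N) ≡ N !
  factorial-⋆-ip b N = begin
    (_! ⋆ (λ k → ip k b)) N + ∑ b (ip N)
      ≡⟨ cong₂ _+_ (⋆-cong (sym ∘ factorial-byParts) (λ k → ip-byParts k b) N) (∑-cong b (λ q _ → ip-byParts N q)) ⟩
    (byParts (λ _ → 1) ⋆ byParts (λ p → χ (p ≡ᵇ b))) N + ∑ b (λ q → byParts (λ p → χ (p ≡ᵇ q)) N)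
      ≡⟨ cong₂ _+_ (trans (byParts-⋆ (λ _ → 1) (λ p → χ (p ≡ᵇ b)) N) (byParts-cong (⋆-χ≡ᵇ (λ _ → 1) b) N))
                   (byParts-∑ b (λ q p → χ (p ≡ᵇ q)) N) ⟩
    byParts (λ p → χ (b <ᵇ suc p) * 1) N + byParts (λ p → ∑ b (λ q → χ (p ≡ᵇ q))) N
      ≡⟨ byParts-+ (λ p → χ (b <ᵇ suc p) * 1) (λ p → ∑ b (λ q → χ (p ≡ᵇ q))) N ⟩
    byParts (λ p → χ (b <ᵇ suc p) * 1 + ∑ b (λ q → χ (p ≡ᵇ q))) N
      ≡⟨ byParts-cong exactly-one N ⟩
    byParts (λ _ → 1) N
      ≡⟨ factorial-byParts N ⟩
    N !
      ∎
    where
    exactly-one : ∀ p → χ (b <ᵇ suc p) * 1 + ∑ b (λ q → χ (p ≡ᵇ q)) ≡ 1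
    exactly-one p = begin
      χ (b <ᵇ suc p) * 1 + ∑ b (λ q → χ (p ≡ᵇ q))
        ≡⟨ cong (χ (b <ᵇ suc p) * 1 +_) (∑-cong b (λ q _ → trans (cong χ (≡ᵇ-comm p q)) (sym (ℕP.*-identityʳ _)))) ⟩
      χ (b <ᵇ suc p) * 1 + ∑ b (λ q → χ (q ≡ᵇ p) * 1)
        ≡⟨ cong (χ (b <ᵇ suc p) * 1 +_) (∑-χ≡ᵇ b p (λ _ → 1)) ⟩
      χ (b <ᵇ suc p) * 1 + χ (p <ᵇ b) * 1
        ≡⟨ cong₂ _+_ (ℕP.*-identityʳ (χ (b <ᵇ suc p))) (ℕP.*-identityʳ (χ (p <ᵇ b))) ⟩
      χ (b <ᵇ suc p) + χ (p <ᵇ b)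
        ≡⟨ χ-<ᵇ-complement b p ⟩
      1 ∎

  numParts-suc : ∀ {n} (σ : Vec (Fin (suc n)) (suc n)) → numParts σ ≡ suc (cuts σ n)
  numParts-suc {n} σ = trans (numParts≡cuts σ) (trans (cong (λ c → cuts σ n + χ c) (isCutᵇ-n σ)) (ℕP.+-comm _ 1))

  ip-suc-0 : ∀ n → ip (suc n) 0 ≡ 0
  ip-suc-0 n = begin
    ip (suc n) 0                            ≡⟨ ip-byParts (suc n) 0 ⟩
    byParts (λ p → χ (p ≡ᵇ 0)) (suc n)      ≡⟨ ∑ᵥ-cong (suc n) (suc n) no-parts ⟩
    ∑ᵥ (suc n) (suc n) (λ _ → 0)            ≡⟨ ∑ₗ-zero (allVecs (suc n) (suc n)) ⟩
    0                                       ∎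
    where
    no-parts : ∀ σ → χ (injectiveᵇ σ) * χ (numParts σ ≡ᵇ 0) ≡ 0
    no-parts σ = trans (cong (λ p → χ (injectiveᵇ σ) * χ (p ≡ᵇ 0)) (numParts-suc σ)) (ℕP.*-zeroʳ (χ (injectiveᵇ σ)))

  ip≤! : ∀ m n → ip n m ≤ n !
  ip≤! m n = ℕP.≤-trans (ListP.length-filter (T? ∘ (λ σ → numParts σ ≡ᵇ m)) (perms n)) (ℕP.≤-reflexive (length-perms n))

module FactorialSeries where

  open Factorials using (middleConstant; middle-bound)
  open Data.Nat using (_!; z≤n; s≤s; s≤s⁻¹)
  open ℤ using (ℤ; +_; 0ℤ; 1ℤ; _+_; _*_; _-_; -_; ∣_∣)
  open import Data.Integer.Solver using (module +-*-Solver)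
  open +-*-Solver using (solve; _:*_; _:+_; _:-_; :-_; _:=_; con)
  open Sumℤ

  ∑-neg : ∀ n (g : ℕ → ℤ) → ∑ n (λ i → - g i) ≡ - ∑ n g
  ∑-neg zero    g = refl
  ∑-neg (suc n) g = trans (cong (_+ - g n) (∑-neg n g)) (sym (ℤP.neg-distrib-+ (∑ n g) (g n)))

  ∑-− : ∀ n (g h : ℕ → ℤ) → ∑ n (λ i → g i - h i) ≡ ∑ n g - ∑ n h
  ∑-− n g h = trans (∑-+ n g (λ i → - h i)) (cong (_+_ (∑ n g)) (∑-neg n h))

  +-∑ : ∀ n (g : ℕ → ℕ) → + Sumℕ.∑ n g ≡ ∑ n (+_ ∘ g)
  +-∑ zero    g = refl
  +-∑ (suc n) g = trans (ℤP.pos-+ (Sumℕ.∑ n g) (g n)) (cong (_+ + g n) (+-∑ n g))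

  +-⋆ : ∀ (g h : ℕ → ℕ) n → + (g Sumℕ.⋆ h) n ≡ ((+_ ∘ g) ⋆ (+_ ∘ h)) n
  +-⋆ g h n = trans (+-∑ (suc n) _) (∑-cong (suc n) (λ j _ → ℤP.pos-* (g j) (h (n ∸ j))))

  pos-difference : ∀ {x y z} → x ℕ.+ y ≡ z → + x ≡ + z - + y
  pos-difference {x} {y} refl =
    trans (solve 2 (λ x y → x := (x :+ y) :- y) refl (+ x) (+ y)) (cong (_- + y) (sym (ℤP.pos-+ x y)))

  ∣∑∣≤∑∣∣ : ∀ n (g : ℕ → ℤ) → ∣ ∑ n g ∣ ℕ.≤ Sumℕ.∑ n (∣_∣ ∘ g)
  ∣∑∣≤∑∣∣ zero    g = z≤n
  ∣∑∣≤∑∣∣ (suc n) g =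
    ℕP.≤-trans (ℤP.∣i+j∣≤∣i∣+∣j∣ (∑ n g) (g n)) (ℕP.+-monoˡ-≤ ∣ g n ∣ (∣∑∣≤∑∣∣ n g))

  ∣∑-weighted∣≤ : ∀ n (w : ℕ → ℕ) (e : ℕ → ℤ) B → (∀ j → j ℕ.< n → w j ℕ.* ∣ e j ∣ ℕ.≤ w j ℕ.* B) →
    ∣ ∑ n (λ j → + w j * e j) ∣ ℕ.≤ Sumℕ.∑ n w ℕ.* B
  ∣∑-weighted∣≤ n w e B bound = begin
    ∣ ∑ n (λ j → + w j * e j) ∣           ≤⟨ ∣∑∣≤∑∣∣ n _ ⟩
    Sumℕ.∑ n (λ j → ∣ + w j * e j ∣)      ≡⟨ Sumℕ.∑-cong n (λ j _ → ℤP.abs-* (+ w j) (e j)) ⟩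
    Sumℕ.∑ n (λ j → w j ℕ.* ∣ e j ∣)      ≤⟨ ∑-mono n bound ⟩
    Sumℕ.∑ n (λ j → w j ℕ.* B)            ≡⟨ Sumℕ.∑-*ʳ n B w ⟩
    Sumℕ.∑ n w ℕ.* B                      ∎
    where open ℕP.≤-Reasoning

  ⋆-second-difference : ∀ (g x y z : ℕ → ℤ) c n →
    (g ⋆ (λ i → c * ((x i - + 2 * y i) + z i))) n ≡ c * (((g ⋆ x) n - + 2 * (g ⋆ y) n) + (g ⋆ z) n)
  ⋆-second-difference g x y z c n = begin
    ∑ (suc n) (λ j → g j * (c * ((x (n ∸ j) - + 2 * y (n ∸ j)) + z (n ∸ j))))
      ≡⟨ ∑-cong (suc n) (λ j _ → solve 5 (λ g c x y z → g :* (c :* ((x :- con (+ 2) :* y) :+ z))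
                                               := c :* ((g :* x :- con (+ 2) :* (g :* y)) :+ g :* z))
                                       refl (g j) c (x (n ∸ j)) (y (n ∸ j)) (z (n ∸ j))) ⟩
    ∑ (suc n) (λ j → c * ((gx j - + 2 * gy j) + gz j))
      ≡⟨ ∑-*ˡ (suc n) c _ ⟩
    c * ∑ (suc n) (λ j → (gx j - + 2 * gy j) + gz j)
      ≡⟨ cong (c *_) (trans (∑-+ (suc n) _ gz) (cong (_+ ∑ (suc n) gz)
           (trans (∑-− (suc n) gx (λ j → + 2 * gy j)) (cong (_-_ (∑ (suc n) gx)) (∑-*ˡ (suc n) (+ 2) gy))))) ⟩
    c * (((g ⋆ x) n - + 2 * (g ⋆ y) n) + (g ⋆ z) n)
      ∎
    where
    open ≡-Reasoning
    gx gy gz : ℕ → ℤ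
    gx j = g j * x (n ∸ j)
    gy j = g j * y (n ∸ j)
    gz j = g j * z (n ∸ j)

  series : (ℕ → ℤ) → ℕ → ℕ → ℤ
  series α r n = ∑ (suc r) (λ k → α k * + ((n ∸ k) !))

  series-cong : ∀ {α β : ℕ → ℤ} r → (∀ k → k ℕ.≤ r → α k ≡ β k) → ∀ n → series α r n ≡ series β r n
  series-cong r α≡β n = ∑-cong (suc r) (λ k k≤r → cong (_* + ((n ∸ k) !)) (α≡β k (s≤s⁻¹ k≤r)))

  series-+ : ∀ (α β : ℕ → ℤ) r n → series (λ k → α k + β k) r n ≡ series α r n + series β r n
  series-+ α β r n = trans (∑-cong (suc r) (λ k _ → ℤP.*-distribʳ-+ (+ ((n ∸ k) !)) (α k) (β k))) (∑-+ (suc r) _ _)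

  series-− : ∀ (α β : ℕ → ℤ) r n → series (λ k → α k - β k) r n ≡ series α r n - series β r n
  series-− α β r n = trans
    (∑-cong (suc r) (λ k _ → solve 3 (λ a b f → (a :- b) :* f := a :* f :- b :* f) refl (α k) (β k) (+ ((n ∸ k) !))))
    (∑-− (suc r) _ _)

  series-δ : ∀ r n → series δ r n ≡ + (n !)
  series-δ r n = begin
    series δ r n
      ≡⟨ ∑-head r (λ k → δ k * + ((n ∸ k) !)) ⟩
    1ℤ * + (n !) + ∑ r (λ k → 0ℤ * + ((n ∸ suc k) !))
      ≡⟨ cong₂ _+_ (ℤP.*-identityˡ (+ (n !))) (∑-cong r (λ k _ → ℤP.*-zeroˡ (+ ((n ∸ suc k) !)))) ⟩
    + (n !) + ∑ r (λ _ → 0ℤ)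
      ≡⟨ cong (_+_ (+ (n !))) (∑-zero r) ⟩
    + (n !) + 0ℤ
      ≡⟨ ℤP.+-identityʳ (+ (n !)) ⟩
    + (n !)
      ∎
    where open ≡-Reasoning

  series-0 : ∀ r n → series (λ _ → 0ℤ) r n ≡ 0ℤ
  series-0 r n = ∑-zero (suc r)

  series-⋆ : ∀ (g β : ℕ → ℤ) r n → series (g ⋆ β) r n ≡ ∑ (suc r) (λ j → g j * series β (r ∸ j) (n ∸ j))
  series-⋆ g β r n = begin
    ∑ (suc r) (λ t → (g ⋆ β) t * + ((n ∸ t) !))
      ≡⟨ ∑-cong (suc r) (λ t _ → trans (sym (∑-*ʳ (suc t) (+ ((n ∸ t) !)) _))
           (∑-cong (suc t) (λ j j≤t → cong (λ m → g j * β (t ∸ j) * + ((n ∸ m) !))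
                                          (sym (ℕP.m+[n∸m]≡n (s≤s⁻¹ j≤t)))))) ⟩
    ∑ (suc r) (λ t → ∑ (suc t) (λ j → G j (t ∸ j)))
      ≡⟨ ∑-triangle r G ⟩
    ∑ (suc r) (λ j → ∑ (suc (r ∸ j)) (G j))
      ≡⟨ ∑-cong (suc r) (λ j _ → trans (∑-cong (suc (r ∸ j)) (λ k _ →
           trans (cong (λ m → g j * β k * + (m !)) (sym (ℕP.∸-+-assoc n j k))) (ℤP.*-assoc (g j) (β k) _)))
           (∑-*ˡ (suc (r ∸ j)) (g j) _)) ⟩
    ∑ (suc r) (λ j → g j * series β (r ∸ j) (n ∸ j))
      ∎
    where
    open ≡-Reasoning
    G : ℕ → ℕ → ℤ
    G j k = g j * β k * + ((n ∸ (j ℕ.+ k)) !)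

  ∑-weighted-difference : ∀ m (w x : ℕ → ℕ) (y : ℕ → ℤ) →
    + Sumℕ.∑ m (λ j → w j ℕ.* x j) - ∑ m (λ j → + w j * y j) ≡ ∑ m (λ j → + w j * (+ x j - y j))
  ∑-weighted-difference m w x y = begin
    + Sumℕ.∑ m (λ j → w j ℕ.* x j) - ∑ m (λ j → + w j * y j)
      ≡⟨ cong (_- ∑ m (λ j → + w j * y j)) (trans (+-∑ m _) (∑-cong m (λ j _ → ℤP.pos-* (w j) (x j)))) ⟩
    ∑ m (λ j → + w j * + x j) - ∑ m (λ j → + w j * y j)
      ≡⟨ ∑-− m _ _ ⟨
    ∑ m (λ j → + w j * + x j - + w j * y j)
      ≡⟨ ∑-cong m (λ j _ → solve 3 (λ w x y → w :* x :- w :* y := w :* (x :- y)) refl (+ w j) (+ x j) (y j)) ⟩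
    ∑ m (λ j → + w j * (+ x j - y j))
      ∎
    where open ≡-Reasoning

  record Expansion (a α : ℕ → ℤ) (r : ℕ) : Set where
    constructor expansion
    field
      constant threshold : ℕ
      bound : ∀ n → threshold ℕ.≤ n → ∣ a n - series α r n ∣ ℕ.≤ constant ℕ.* (n ∸ suc r) !

  expansion-coeff-cong : ∀ {a α β r} → (∀ k → k ℕ.≤ r → α k ≡ β k) → Expansion a α r → Expansion a β r
  expansion-coeff-cong {a} {r = r} α≡β (expansion C N bound) = expansion C N λ n N≤n →
    subst (λ s → ∣ a n - s ∣ ℕ.≤ C ℕ.* (n ∸ suc r) !) (series-cong r α≡β n) (bound n N≤n)

  expansion-cong : ∀ {a b α r} → (∀ n → a n ≡ b n) → Expansion a α r → Expansion b α r
  expansion-cong {α = α} {r} a≡b (expansion C N bound) = expansion C N λ n N≤n →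
    subst (λ x → ∣ x - series α r n ∣ ℕ.≤ C ℕ.* (n ∸ suc r) !) (a≡b n) (bound n N≤n)

  expansion-exact : ∀ {a α r} N₀ → (∀ n → N₀ ℕ.≤ n → a n ≡ series α r n) → Expansion a α r
  expansion-exact {α = α} {r} N₀ exact = expansion 0 N₀ λ n N₀≤n →
    ℕP.≤-reflexive (cong ∣_∣ (trans (cong (_- series α r n) (exact n N₀≤n)) (ℤP.+-inverseʳ (series α r n))))

  expansion-− : ∀ {a b α β r} → Expansion a α r → Expansion b β r → Expansion (λ n → a n - b n) (λ k → α k - β k) r
  expansion-− {a} {b} {α} {β} {r} (expansion C₁ N₁ bound₁) (expansion C₂ N₂ bound₂) =
    expansion (C₁ ℕ.+ C₂) (N₁ ℕ.+ N₂) λ n le → begin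
    ∣ a n - b n - series (λ k → α k - β k) r n ∣
      ≡⟨ cong ∣_∣ (trans (cong (_-_ (a n - b n)) (series-− α β r n))
                         (solve 4 (λ x y u v → x :- y :- (u :- v) := (x :- u) :- (y :- v)) refl (a n) (b n) (series α r n) (series β r n))) ⟩
    ∣ (a n - series α r n) - (b n - series β r n) ∣
      ≤⟨ ℤP.∣i-j∣≤∣i∣+∣j∣ (a n - series α r n) (b n - series β r n) ⟩
    ∣ a n - series α r n ∣ ℕ.+ ∣ b n - series β r n ∣
      ≤⟨ ℕP.+-mono-≤ (bound₁ n (ℕP.m+n≤o⇒m≤o N₁ le)) (bound₂ n (ℕP.m+n≤o⇒n≤o N₁ le)) ⟩
    C₁ ℕ.* (n ∸ suc r) ! ℕ.+ C₂ ℕ.* (n ∸ suc r) !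
      ≡⟨ ℕP.*-distribʳ-+ ((n ∸ suc r) !) C₁ C₂ ⟨
    (C₁ ℕ.+ C₂) ℕ.* (n ∸ suc r) !
      ∎
    where open ℕP.≤-Reasoning

  record UniformExpansion (a α : ℕ → ℤ) (orders : ℕ → Set) : Set where
    constructor uniform
    field
      constant threshold : ℕ
      bound : ∀ s → orders s → ∀ n → threshold ℕ.≤ n → ∣ a n - series α s n ∣ ℕ.≤ constant ℕ.* (n ∸ suc s) !

  uniform≤ : ∀ {a α} r → (∀ s → s ℕ.≤ r → Expansion a α s) → UniformExpansion a α (ℕ._≤ r)
  uniform≤ zero    E with E 0 z≤n
  ... | expansion C N bound = uniform C N λ { s z≤n → bound }
  uniform≤ {a} {α} (suc r) E with uniform≤ r (λ s s≤r → E s (ℕP.m≤n⇒m≤1+n s≤r)) | E (suc r) ℕP.≤-refl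
  ... | uniform C₁ N₁ bound₁ | expansion C₂ N₂ bound₂ = uniform (C₁ ℕ.+ C₂) (N₁ ℕ.+ N₂) bound
    where
    bound : ∀ s → s ℕ.≤ suc r → ∀ n → N₁ ℕ.+ N₂ ℕ.≤ n →
            ∣ a n - series α s n ∣ ℕ.≤ (C₁ ℕ.+ C₂) ℕ.* (n ∸ suc s) !
    bound s s≤1+r n le with ℕP.m≤n⇒m<n∨m≡n s≤1+r
    ... | inj₁ s<1+r = ℕP.≤-trans (bound₁ s (s≤s⁻¹ s<1+r) n (ℕP.m+n≤o⇒m≤o N₁ le)) (ℕP.*-monoˡ-≤ _ (ℕP.m≤m+n C₁ C₂))
    ... | inj₂ refl = ℕP.≤-trans (bound₂ n (ℕP.m+n≤o⇒n≤o N₁ le)) (ℕP.*-monoˡ-≤ _ (ℕP.m≤n+m C₂ C₁))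

  uniform< : ∀ {a α} r → (∀ s → s ℕ.< r → Expansion a α s) → UniformExpansion a α (ℕ._< r)
  uniform< zero    E = uniform 0 0 λ s ()
  uniform< (suc r) E with uniform≤ r (λ s s≤r → E s (s≤s s≤r))
  ... | uniform C N bound = uniform C N λ s s<1+r → bound s (s≤s⁻¹ s<1+r)

  module ProductExpansion (a b : ℕ → ℕ) (α β : ℕ → ℤ) (r : ℕ)
    (a≤! : ∀ n → a n ℕ.≤ n !) (b≤! : ∀ n → b n ℕ.≤ n !) (b0≡0 : b 0 ≡ 0)
    (EA : UniformExpansion (+_ ∘ a) α (ℕ._< r)) (EB : UniformExpansion (+_ ∘ b) β (ℕ._≤ r)) where

    open UniformExpansion EA renaming (constant to CA; threshold to NA; bound to boundA)
    open UniformExpansion EB renaming (constant to CB; threshold to NB; bound to boundB)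

    coefficients : ℕ → ℤ
    coefficients t = ((+_ ∘ a) ⋆ β) t + ((+_ ∘ b) ⋆ α) t

    errorA errorB : ℕ → ℕ → ℤ
    errorA n i = + a (n ∸ i) - series α (r ∸ i) (n ∸ i)
    errorB n j = + b (n ∸ j) - series β (r ∸ j) (n ∸ j)

    middle : ℕ → ℕ
    middle t = ((λ i → b (suc r ℕ.+ i)) Sumℕ.⋆ (λ i → a (suc r ℕ.+ i))) t

    error-decomposition : ∀ t → let n = suc r ℕ.+ (suc r ℕ.+ t) in
      + (a Sumℕ.⋆ b) n - series coefficients r n
        ≡ ∑ (suc r) (λ j → + a j * errorB n j) + ∑ (suc r) (λ i → + b i * errorA n i) + + middle t
    error-decomposition t = begin
      + (a Sumℕ.⋆ b) n - series coefficients r n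
        ≡⟨ cong₂ _-_ (cong +_ (Sumℕ.⋆-ends a b (suc r) t)) (series-+ ((+_ ∘ a) ⋆ β) ((+_ ∘ b) ⋆ α) r n) ⟩
      + (Hab ℕ.+ (Hba ℕ.+ middle t)) - (series ((+_ ∘ a) ⋆ β) r n + series ((+_ ∘ b) ⋆ α) r n)
        ≡⟨ cong₂ _-_ (trans (ℤP.pos-+ Hab _) (cong (_+_ (+ Hab)) (ℤP.pos-+ Hba (middle t))))
                     (cong₂ _+_ (series-⋆ (+_ ∘ a) β r n) (series-⋆ (+_ ∘ b) α r n)) ⟩
      (+ Hab + (+ Hba + + middle t)) - (E₁ + E₂)
        ≡⟨ solve 5 (λ x y m e₁ e₂ → (x :+ (y :+ m)) :- (e₁ :+ e₂) := (x :- e₁) :+ (y :- e₂) :+ m) refl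
             (+ Hab) (+ Hba) (+ middle t) E₁ E₂ ⟩
      (+ Hab - E₁) + (+ Hba - E₂) + + middle t
        ≡⟨ cong₂ (λ x y → x + y + + middle t) (∑-weighted-difference (suc r) a (b ∘ (n ∸_)) _)
                                              (∑-weighted-difference (suc r) b (a ∘ (n ∸_)) _) ⟩
      ∑ (suc r) (λ j → + a j * errorB n j) + ∑ (suc r) (λ i → + b i * errorA n i) + + middle t
        ∎
      where
      open ≡-Reasoning
      n = suc r ℕ.+ (suc r ℕ.+ t)
      Hab = Sumℕ.∑ (suc r) (λ j → a j ℕ.* b (n ∸ j))
      Hba = Sumℕ.∑ (suc r) (λ i → b i ℕ.* a (n ∸ i))
      E₁ = ∑ (suc r) (λ j → + a j * series β (r ∸ j) (n ∸ j))
      E₂ = ∑ (suc r) (λ i → + b i * series α (r ∸ i) (n ∸ i))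

    orders-shift : ∀ n {j} → j ℕ.≤ r → n ∸ j ∸ suc (r ∸ j) ≡ n ∸ suc r
    orders-shift n {j} j≤r =
      trans (ℕP.∸-+-assoc n j (suc (r ∸ j))) (cong (n ∸_) (trans (ℕP.+-suc j (r ∸ j)) (cong suc (ℕP.m+[n∸m]≡n j≤r))))

    head-bound : ∀ n → (∀ j → j ℕ.≤ r → NB ℕ.≤ n ∸ j) →
      ∣ ∑ (suc r) (λ j → + a j * errorB n j) ∣ ℕ.≤ Sumℕ.∑ (suc r) a ℕ.* (CB ℕ.* (n ∸ suc r) !)
    head-bound n thresholdB = ∣∑-weighted∣≤ (suc r) a (errorB n) _ λ j j≤r → ℕP.*-monoʳ-≤ (a j)
      (subst (λ m → ∣ errorB n j ∣ ℕ.≤ CB ℕ.* m !) (orders-shift n (s≤s⁻¹ j≤r))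
        (boundB (r ∸ j) (ℕP.m∸n≤m r j) (n ∸ j) (thresholdB j (s≤s⁻¹ j≤r))))

    -- The i = 0 term vanishes because b 0 = 0; this is why a is only needed up to order r - 1.
    tail-bound : ∀ n → (∀ i → i ℕ.≤ r → NA ℕ.≤ n ∸ i) →
      ∣ ∑ (suc r) (λ i → + b i * errorA n i) ∣ ℕ.≤ Sumℕ.∑ (suc r) b ℕ.* (CA ℕ.* (n ∸ suc r) !)
    tail-bound n thresholdA = ∣∑-weighted∣≤ (suc r) b (errorA n) _ term
      where
      term : ∀ i → i ℕ.< suc r → b i ℕ.* ∣ errorA n i ∣ ℕ.≤ b i ℕ.* (CA ℕ.* (n ∸ suc r) !)
      term zero    _     rewrite b0≡0 = z≤n
      term (suc i) i<r = ℕP.*-monoʳ-≤ (b (suc i))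
        (subst (λ m → ∣ errorA n (suc i) ∣ ℕ.≤ CA ℕ.* m !) (orders-shift n (s≤s⁻¹ i<r))
          (boundA (r ∸ suc i) (ℕP.∸-monoʳ-< (s≤s z≤n) (s≤s⁻¹ i<r)) (n ∸ suc i) (thresholdA (suc i) (s≤s⁻¹ i<r))))

    middle-≤ : ∀ t → middle t ℕ.≤ middleConstant r ℕ.* (suc r ℕ.+ t) !
    middle-≤ t = ℕP.≤-trans (⋆-mono (b≤! ∘ (suc r ℕ.+_)) (a≤! ∘ (suc r ℕ.+_)) t) (middle-bound r t)

    C N : ℕ
    C = Sumℕ.∑ (suc r) a ℕ.* CB ℕ.+ Sumℕ.∑ (suc r) b ℕ.* CA ℕ.+ middleConstant r
    N = (NA ℕ.+ NB) ℕ.+ (suc r ℕ.+ suc r)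

    bound-at : ∀ t → let n = suc r ℕ.+ (suc r ℕ.+ t) in
      (∀ i → i ℕ.≤ r → NA ℕ.≤ n ∸ i) → (∀ j → j ℕ.≤ r → NB ℕ.≤ n ∸ j) →
      ∣ + (a Sumℕ.⋆ b) n - series coefficients r n ∣ ℕ.≤ C ℕ.* (n ∸ suc r) !
    bound-at t thresholdA thresholdB = begin
      ∣ + (a Sumℕ.⋆ b) n - series coefficients r n ∣
        ≡⟨ cong ∣_∣ (error-decomposition t) ⟩
      ∣ D₁ + D₂ + + middle t ∣
        ≤⟨ ℤP.∣i+j∣≤∣i∣+∣j∣ (D₁ + D₂) (+ middle t) ⟩
      ∣ D₁ + D₂ ∣ ℕ.+ middle t
        ≤⟨ ℕP.+-monoˡ-≤ (middle t) (ℤP.∣i+j∣≤∣i∣+∣j∣ D₁ D₂) ⟩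
      ∣ D₁ ∣ ℕ.+ ∣ D₂ ∣ ℕ.+ middle t
        ≤⟨ ℕP.+-mono-≤ (ℕP.+-mono-≤ (head-bound n thresholdB) (tail-bound n thresholdA))
                       (subst (λ m → middle t ℕ.≤ middleConstant r ℕ.* m !) (sym (ℕP.m+n∸m≡n (suc r) _)) (middle-≤ t)) ⟩
      Sumℕ.∑ (suc r) a ℕ.* (CB ℕ.* F) ℕ.+ Sumℕ.∑ (suc r) b ℕ.* (CA ℕ.* F) ℕ.+ middleConstant r ℕ.* F
        ≡⟨ cong₂ (λ x y → x ℕ.+ y ℕ.+ middleConstant r ℕ.* F)
                 (sym (ℕP.*-assoc (Sumℕ.∑ (suc r) a) CB F)) (sym (ℕP.*-assoc (Sumℕ.∑ (suc r) b) CA F)) ⟩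
      Sumℕ.∑ (suc r) a ℕ.* CB ℕ.* F ℕ.+ Sumℕ.∑ (suc r) b ℕ.* CA ℕ.* F ℕ.+ middleConstant r ℕ.* F
        ≡⟨ trans (ℕP.*-distribʳ-+ F (Sumℕ.∑ (suc r) a ℕ.* CB ℕ.+ Sumℕ.∑ (suc r) b ℕ.* CA) (middleConstant r))
                 (cong (ℕ._+ middleConstant r ℕ.* F) (ℕP.*-distribʳ-+ F (Sumℕ.∑ (suc r) a ℕ.* CB) (Sumℕ.∑ (suc r) b ℕ.* CA))) ⟨
      C ℕ.* F
        ∎
      where
      open ℕP.≤-Reasoning
      n = suc r ℕ.+ (suc r ℕ.+ t)
      F = (n ∸ suc r) !
      D₁ = ∑ (suc r) (λ j → + a j * errorB n j)
      D₂ = ∑ (suc r) (λ i → + b i * errorA n i)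

    result : Expansion (λ n → + (a Sumℕ.⋆ b) n) coefficients r
    result = expansion C N λ n N≤n → bound-from n (n ∸ (suc r ℕ.+ suc r)) (split n (ℕP.m+n≤o⇒n≤o (NA ℕ.+ NB) N≤n)) N≤n
      where
      split : ∀ n → suc r ℕ.+ suc r ℕ.≤ n → n ≡ suc r ℕ.+ (suc r ℕ.+ (n ∸ (suc r ℕ.+ suc r)))
      split n le = trans (sym (ℕP.m+[n∸m]≡n le)) (ℕP.+-assoc (suc r) (suc r) _)
      below-threshold : ∀ {M n} i → M ℕ.≤ NA ℕ.+ NB → i ℕ.≤ r → N ℕ.≤ n → M ℕ.≤ n ∸ i
      below-threshold i M≤ i≤r N≤n = ℕP.m+n≤o⇒m≤o∸n _ (ℕP.≤-trans
        (ℕP.+-mono-≤ M≤ (ℕP.≤-trans i≤r (ℕP.≤-trans (ℕP.n≤1+n r) (ℕP.m≤m+n (suc r) (suc r))))) N≤n)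
      bound-from : ∀ n t → n ≡ suc r ℕ.+ (suc r ℕ.+ t) → N ℕ.≤ n →
        ∣ + (a Sumℕ.⋆ b) n - series coefficients r n ∣ ℕ.≤ C ℕ.* (n ∸ suc r) !
      bound-from _ t refl N≤n = bound-at t (λ i i≤r → below-threshold i (ℕP.m≤m+n NA NB) i≤r N≤n)
                                           (λ j j≤r → below-threshold j (ℕP.m≤n+m NB NA) j≤r N≤n)

  expansion-⋆ : ∀ (a b : ℕ → ℕ) (α β : ℕ → ℤ) r →
    (∀ n → a n ℕ.≤ n !) → (∀ n → b n ℕ.≤ n !) → b 0 ≡ 0 →
    (∀ s → s ℕ.< r → Expansion (+_ ∘ a) α s) → (∀ s → s ℕ.≤ r → Expansion (+_ ∘ b) β s) →
    Expansion (λ n → + (a Sumℕ.⋆ b) n) (λ t → ((+_ ∘ a) ⋆ β) t + ((+_ ∘ b) ⋆ α) t) r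
  expansion-⋆ a b α β r a≤! b≤! b0≡0 EA EB =
    ProductExpansion.result a b α β r a≤! b≤! b0≡0 (uniform< r EA) (uniform≤ r EB)

module IndecomposableExpansion where

  open Parts using (ip-⋆; factorial-⋆-ip; ip-suc-0; ip≤!)
  open FactorialSeries
  open Data.Nat using (_!; z≤n)
  open ℤ using (ℤ; +_; 0ℤ; _+_; _*_; _-_; -_)
  open import Data.Nat.Induction using (<-rec)
  open import Data.Integer.Solver using (module +-*-Solver)
  open +-*-Solver using (solve; _:*_; _:+_; _:-_; :-_; _:=_; con)
  open ≡-Reasoning
  open Sumℤ

  P : ℕ → ℕ → ℤ
  P m k = + ip k m

  Δ² : ℕ → ℕ → ℤ
  Δ² m k = (P m k - + 2 * P (suc m) k) + P (suc (suc m)) k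

  D : ℕ → ℕ → ℤ
  D m k = + suc m * Δ² m k

  factorialℤ : ℕ → ℤ
  factorialℤ n = + (n !)

  factorial⁺ : ℕ → ℕ
  factorial⁺ zero    = 0
  factorial⁺ (suc n) = suc n !

  factorial⁺≤! : ∀ n → factorial⁺ n ℕ.≤ n !
  factorial⁺≤! zero    = z≤n
  factorial⁺≤! (suc n) = ℕP.≤-refl

  !≡factorial⁺+δ : ∀ n → n ! ≡ factorial⁺ n ℕ.+ Sumℕ.δ n
  !≡factorial⁺+δ zero    = refl
  !≡factorial⁺+δ (suc n) = sym (ℕP.+-identityʳ _)

  factorialℤ≡factorial⁺+δ : ∀ n → factorialℤ n ≡ + factorial⁺ n + δ n
  factorialℤ≡factorial⁺+δ zero    = refl
  factorialℤ≡factorial⁺+δ (suc n) = sym (ℤP.+-identityʳ _)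

  private
    cong₃ : ∀ {x y z x′ y′ z′ : ℤ} (g : ℤ → ℤ → ℤ → ℤ) →
            x ≡ x′ → y ≡ y′ → z ≡ z′ → g x y z ≡ g x′ y′ z′
    cong₃ g refl refl refl = refl

  P-0 : ∀ k → P 0 k ≡ δ k
  P-0 zero    = refl
  P-0 (suc k) = cong +_ (ip-suc-0 k)

  P-⋆-P : ∀ a b k → (P a ⋆ P b) k ≡ P (a ℕ.+ b) k
  P-⋆-P a b k = trans (sym (+-⋆ (λ i → ip i a) (λ i → ip i b) k)) (cong +_ (ip-⋆ a b k))

  P-⋆-Δ² : ∀ a b c k → (P a ⋆ (λ i → c * Δ² b i)) k ≡ c * Δ² (a ℕ.+ b) k
  P-⋆-Δ² a b c k = trans (⋆-second-difference (P a) (P b) (P (suc b)) (P (suc (suc b))) c k)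
    (cong (c *_) (cong₃ (λ x y z → (x - + 2 * y) + z) (P-⋆-P a b k)
      (trans (P-⋆-P a (suc b) k) (cong (λ m → P m k) (ℕP.+-suc a b)))
      (trans (P-⋆-P a (suc (suc b)) k) (cong (λ m → P m k) (trans (ℕP.+-suc a (suc b)) (cong suc (ℕP.+-suc a b)))))))

  factorial-⋆-P : ∀ b k → (factorialℤ ⋆ P b) k ≡ factorialℤ k - ∑ b (λ q → P q k)
  factorial-⋆-P b k = begin
    (factorialℤ ⋆ P b) k                      ≡⟨ +-⋆ _! (λ i → ip i b) k ⟨
    + (_! Sumℕ.⋆ (λ i → ip i b)) k            ≡⟨ pos-difference (factorial-⋆-ip b k) ⟩
    factorialℤ k - + Sumℕ.∑ b (ip k)          ≡⟨ cong (_-_ (factorialℤ k)) (+-∑ b (ip k)) ⟩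
    factorialℤ k - ∑ b (λ q → P q k)          ∎

  factorial-⋆-D0 : ∀ k → (factorialℤ ⋆ D 0) k ≡ P 0 k - P 1 k
  factorial-⋆-D0 k = begin
    (factorialℤ ⋆ D 0) k
      ≡⟨ ⋆-second-difference factorialℤ (P 0) (P 1) (P 2) (+ 1) k ⟩
    + 1 * (((factorialℤ ⋆ P 0) k - + 2 * (factorialℤ ⋆ P 1) k) + (factorialℤ ⋆ P 2) k)
      ≡⟨ cong₃ (λ x y z → + 1 * ((x - + 2 * y) + z)) (factorial-⋆-P 0 k) (factorial-⋆-P 1 k) (factorial-⋆-P 2 k) ⟩
    + 1 * (((u - 0ℤ) - + 2 * (u - (0ℤ + P 0 k))) + (u - ((0ℤ + P 0 k) + P 1 k)))
      ≡⟨ solve 3 (λ u p₀ p₁ → con (+ 1) :* (((u :- con 0ℤ) :- con (+ 2) :* (u :- (con 0ℤ :+ p₀)))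
                                           :+ (u :- ((con 0ℤ :+ p₀) :+ p₁)))
                              := p₀ :- p₁) refl u (P 0 k) (P 1 k) ⟩
    P 0 k - P 1 k
      ∎
    where u = factorialℤ k

  factorial⁺-⋆ : ∀ (g : ℕ → ℤ) k → ((+_ ∘ factorial⁺) ⋆ g) k ≡ (factorialℤ ⋆ g) k - g k
  factorial⁺-⋆ g k = begin
    ((+_ ∘ factorial⁺) ⋆ g) k
      ≡⟨ solve 2 (λ x y → x := (x :+ y) :- y) refl _ (g k) ⟩
    ((+_ ∘ factorial⁺) ⋆ g) k + g k - g k
      ≡⟨ cong (_- g k) (cong₂ _+_ (⋆-comm (+_ ∘ factorial⁺) g k) (sym (⋆-identityʳ g k))) ⟩
    (g ⋆ (+_ ∘ factorial⁺)) k + (g ⋆ δ) k - g k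
      ≡⟨ cong (_- g k) (⋆-distribˡ-+ g (+_ ∘ factorial⁺) δ k) ⟨
    (g ⋆ (λ i → + factorial⁺ i + δ i)) k - g k
      ≡⟨ cong (_- g k) (trans (⋆-cong {g = g} (λ _ → refl) (sym ∘ factorialℤ≡factorial⁺+δ) k) (⋆-comm g factorialℤ k)) ⟩
    (factorialℤ ⋆ g) k - g k
      ∎

  -- Counting permutations by the size of their last indecomposable part.
  ip1-recurrence : ∀ n → P 1 n ≡ (factorialℤ n - + ((λ k → ip k 1) Sumℕ.⋆ factorial⁺) n) - P 0 n
  ip1-recurrence n = begin
    + ip n 1                          ≡⟨ pos-difference counted ⟩
    factorialℤ n - + (conv ℕ.+ ip n 0)  ≡⟨ cong (_-_ (factorialℤ n)) (ℤP.pos-+ conv (ip n 0)) ⟩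
    factorialℤ n - (+ conv + P 0 n)   ≡⟨ solve 3 (λ u c p → u :- (c :+ p) := (u :- c) :- p) refl (factorialℤ n) (+ conv) (P 0 n) ⟩
    (factorialℤ n - + conv) - P 0 n   ∎
    where
    conv = ((λ k → ip k 1) Sumℕ.⋆ factorial⁺) n
    last-part : (_! Sumℕ.⋆ (λ k → ip k 1)) n ≡ conv ℕ.+ ip n 1
    last-part = begin
      (_! Sumℕ.⋆ (λ k → ip k 1)) n
        ≡⟨ Sumℕ.⋆-comm _! (λ k → ip k 1) n ⟩
      ((λ k → ip k 1) Sumℕ.⋆ _!) n
        ≡⟨ Sumℕ.⋆-cong {g = λ k → ip k 1} (λ _ → refl) !≡factorial⁺+δ n ⟩
      ((λ k → ip k 1) Sumℕ.⋆ (λ k → factorial⁺ k ℕ.+ Sumℕ.δ k)) n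
        ≡⟨ Sumℕ.⋆-distribˡ-+ (λ k → ip k 1) factorial⁺ Sumℕ.δ n ⟩
      conv ℕ.+ ((λ k → ip k 1) Sumℕ.⋆ Sumℕ.δ) n
        ≡⟨ cong (conv ℕ.+_) (Sumℕ.⋆-identityʳ (λ k → ip k 1) n) ⟩
      conv ℕ.+ ip n 1
        ∎
    counted : ip n 1 ℕ.+ (conv ℕ.+ ip n 0) ≡ n !
    counted = begin
      ip n 1 ℕ.+ (conv ℕ.+ ip n 0)    ≡⟨ ℕP.+-assoc (ip n 1) conv (ip n 0) ⟨
      ip n 1 ℕ.+ conv ℕ.+ ip n 0      ≡⟨ cong (ℕ._+ ip n 0) (trans (ℕP.+-comm (ip n 1) conv) (sym last-part)) ⟩
      (_! Sumℕ.⋆ (λ k → ip k 1)) n ℕ.+ Sumℕ.∑ 1 (ip n)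
                                      ≡⟨ factorial-⋆-ip 1 n ⟩
      n !                             ∎

  ip1-coefficients : ∀ k → (δ k - ((P 1 ⋆ δ) k + ((+_ ∘ factorial⁺) ⋆ D 0) k)) - 0ℤ ≡ D 0 k
  ip1-coefficients k = begin
    (δ k - ((P 1 ⋆ δ) k + ((+_ ∘ factorial⁺) ⋆ D 0) k)) - 0ℤ
      ≡⟨ cong₃ (λ x y z → (x - (y + z)) - 0ℤ) (sym (P-0 k)) (⋆-identityʳ (P 1) k) (factorial⁺-⋆ (D 0) k) ⟩
    (P 0 k - (P 1 k + ((factorialℤ ⋆ D 0) k - D 0 k))) - 0ℤ
      ≡⟨ cong (λ x → (P 0 k - (P 1 k + (x - D 0 k))) - 0ℤ) (factorial-⋆-D0 k) ⟩
    (P 0 k - (P 1 k + ((P 0 k - P 1 k) - D 0 k))) - 0ℤ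
      ≡⟨ solve 3 (λ p₀ p₁ d → (p₀ :- (p₁ :+ ((p₀ :- p₁) :- d))) :- con 0ℤ := d) refl (P 0 k) (P 1 k) (D 0 k) ⟩
    D 0 k
      ∎

  D0-suc : ∀ k → D 0 (suc k) ≡ - (+ 2 * P 1 (suc k) - P 2 (suc k))
  D0-suc k = begin
    + 1 * ((P 0 (suc k) - + 2 * P 1 (suc k)) + P 2 (suc k))  ≡⟨ cong (λ x → + 1 * ((x - + 2 * P 1 (suc k)) + P 2 (suc k))) (P-0 (suc k)) ⟩
    + 1 * ((0ℤ - + 2 * P 1 (suc k)) + P 2 (suc k))           ≡⟨ solve 2 (λ x y → con (+ 1) :* ((con 0ℤ :- con (+ 2) :* x) :+ y)
                                                                             := :- (con (+ 2) :* x :- y)) refl (P 1 (suc k)) (P 2 (suc k)) ⟩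
    - (+ 2 * P 1 (suc k) - P 2 (suc k))                      ∎

  expansion-factorial : ∀ r → Expansion factorialℤ δ r
  expansion-factorial r = expansion-exact 0 (λ n _ → sym (series-δ r n))

  expansion-factorial⁺ : ∀ r → Expansion (+_ ∘ factorial⁺) δ r
  expansion-factorial⁺ r = expansion-exact 1 exact
    where
    exact : ∀ n → 1 ℕ.≤ n → + factorial⁺ n ≡ series δ r n
    exact (suc n) _ = sym (series-δ r (suc n))

  expansion-P0 : ∀ r → Expansion (P 0) (λ _ → 0ℤ) r
  expansion-P0 r = expansion-exact 1 exact
    where
    exact : ∀ n → 1 ℕ.≤ n → P 0 n ≡ series (λ _ → 0ℤ) r n
    exact (suc n) _ = trans (cong +_ (ip-suc-0 n)) (sym (series-0 r (suc n)))

  expansion-P1 : ∀ r → Expansion (P 1) (D 0) r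
  expansion-P1 = <-rec _ λ r below →
    expansion-coeff-cong (λ k _ → ip1-coefficients k)
      (expansion-cong (sym ∘ ip1-recurrence)
        (expansion-− (expansion-− (expansion-factorial r)
                                  (expansion-⋆ (λ k → ip k 1) factorial⁺ (D 0) δ r (ip≤! 1) factorial⁺≤! refl
                                               (λ s s<r → below s<r) (λ s _ → expansion-factorial⁺ s)))
                     (expansion-P0 r)))

  P-suc-coefficients : ∀ m k → (P (suc m) ⋆ D 0) k + (P 1 ⋆ D m) k ≡ D (suc m) k
  P-suc-coefficients m k = begin
    (P (suc m) ⋆ D 0) k + (P 1 ⋆ D m) k
      ≡⟨ cong₂ _+_ (P-⋆-Δ² (suc m) 0 (+ 1) k) (P-⋆-Δ² 1 m (+ suc m) k) ⟩
    + 1 * Δ² (suc m ℕ.+ 0) k + + suc m * Δ² (suc m) k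
      ≡⟨ cong (λ x → + 1 * Δ² x k + + suc m * Δ² (suc m) k) (ℕP.+-identityʳ (suc m)) ⟩
    + 1 * Δ² (suc m) k + + suc m * Δ² (suc m) k
      ≡⟨ ℤP.*-distribʳ-+ (Δ² (suc m) k) (+ 1) (+ suc m) ⟨
    D (suc m) k
      ∎

  expansion-P : ∀ m r → Expansion (P (suc m)) (D m) r
  expansion-P zero    r = expansion-P1 r
  expansion-P (suc m) r =
    expansion-coeff-cong (λ k _ → P-suc-coefficients m k)
      (expansion-cong (λ n → trans (cong +_ (ip-⋆ (suc m) 1 n)) (cong (λ a → P a n) (ℕP.+-comm (suc m) 1)))
        (expansion-⋆ (λ k → ip k (suc m)) (λ k → ip k 1) (D m) (D 0) r (ip≤! (suc m)) (ip≤! 1) refl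
                     (λ s _ → expansion-P m s) (λ s _ → expansion-P1 s)))

module RationalArithmetic where

  open Data.Nat using (z≤n; s≤s)
  open ℤ using (ℤ; +_; +≤+; -[1+_])
  open ℚ using (ℚ; mkℚ; toℚᵘ; 0ℚ; 1ℚ; _+_; _*_; -_; _≤_; _<_; ∣_∣; ↧ₙ_; *<*)
  open ℚP using (toℚᵘ-injective; toℚᵘ-fromℚᵘ; toℚᵘ-cancel-≤; toℚᵘ-homo-+; toℚᵘ-homo-*; toℚᵘ-homo‿-; toℚᵘ-homo-∣-∣)
  open import Data.Rational.Unnormalised as ℚᵘ using (mkℚᵘ; *≡*; *≤*)
  import Data.Rational.Unnormalised.Properties as ℚᵘP
  open import Data.Integer.Solver using (module +-*-Solver)
  open +-*-Solver using (solve; _:*_; _:+_; _:=_; con)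

  toℚᵘ-ℤtoℚ : ∀ x → toℚᵘ (ℤtoℚ x) ℚᵘ.≃ mkℚᵘ x 0
  toℚᵘ-ℤtoℚ x = toℚᵘ-fromℚᵘ (mkℚᵘ x 0)

  toℚᵘ-invℕ : ∀ d → toℚᵘ (invℕ (suc d)) ℚᵘ.≃ mkℚᵘ (+ 1) d
  toℚᵘ-invℕ d = toℚᵘ-fromℚᵘ (mkℚᵘ (+ 1) d)

  ℤtoℚ-+ : ∀ x y → ℤtoℚ (x ℤ.+ y) ≡ ℤtoℚ x + ℤtoℚ y
  ℤtoℚ-+ x y = toℚᵘ-injective (ℚᵘP.≃-trans (toℚᵘ-ℤtoℚ (x ℤ.+ y)) (ℚᵘP.≃-trans
    (*≡* (solve 2 (λ a b → (a :+ b) :* con (+ 1) := (a :* con (+ 1) :+ b :* con (+ 1)) :* con (+ 1)) refl x y))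
    (ℚᵘP.≃-sym (ℚᵘP.≃-trans (toℚᵘ-homo-+ (ℤtoℚ x) (ℤtoℚ y)) (ℚᵘP.+-cong (toℚᵘ-ℤtoℚ x) (toℚᵘ-ℤtoℚ y))))))

  ℤtoℚ-* : ∀ x y → ℤtoℚ (x ℤ.* y) ≡ ℤtoℚ x * ℤtoℚ y
  ℤtoℚ-* x y = toℚᵘ-injective (ℚᵘP.≃-trans (toℚᵘ-ℤtoℚ (x ℤ.* y)) (ℚᵘP.≃-trans
    (*≡* (solve 2 (λ a b → (a :* b) :* con (+ 1) := (a :* b) :* con (+ 1)) refl x y))
    (ℚᵘP.≃-sym (ℚᵘP.≃-trans (toℚᵘ-homo-* (ℤtoℚ x) (ℤtoℚ y)) (ℚᵘP.*-cong (toℚᵘ-ℤtoℚ x) (toℚᵘ-ℤtoℚ y))))))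

  ℤtoℚ-neg : ∀ x → ℤtoℚ (ℤ.- x) ≡ - ℤtoℚ x
  ℤtoℚ-neg x = toℚᵘ-injective (ℚᵘP.≃-trans (toℚᵘ-ℤtoℚ (ℤ.- x))
    (ℚᵘP.≃-sym (ℚᵘP.≃-trans (toℚᵘ-homo‿- (ℤtoℚ x)) (ℚᵘP.-‿cong (toℚᵘ-ℤtoℚ x)))))

  ℤtoℚ-− : ∀ x y → ℤtoℚ (x ℤ.- y) ≡ ℤtoℚ x ℚ.- ℤtoℚ y
  ℤtoℚ-− x y = trans (ℤtoℚ-+ x (ℤ.- y)) (cong (_+_ (ℤtoℚ x)) (ℤtoℚ-neg y))

  ℤtoℚ-mono-≤ : ∀ {x y} → x ℤ.≤ y → ℤtoℚ x ≤ ℤtoℚ y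
  ℤtoℚ-mono-≤ {x} {y} x≤y = toℚᵘ-cancel-≤
    (ℚᵘP.≤-respʳ-≃ (ℚᵘP.≃-sym (toℚᵘ-ℤtoℚ y)) (ℚᵘP.≤-respˡ-≃ (ℚᵘP.≃-sym (toℚᵘ-ℤtoℚ x))
      (*≤* (subst₂ ℤ._≤_ (sym (ℤP.*-identityʳ x)) (sym (ℤP.*-identityʳ y)) x≤y))))

  ∣ℤtoℚ∣ : ∀ x → ∣ ℤtoℚ x ∣ ≡ ℕtoℚ ℤ.∣ x ∣
  ∣ℤtoℚ∣ x = toℚᵘ-injective (ℚᵘP.≃-trans (toℚᵘ-homo-∣-∣ (ℤtoℚ x))
    (ℚᵘP.≃-trans (ℚᵘP.∣-∣-cong (toℚᵘ-ℤtoℚ x)) (ℚᵘP.≃-sym (toℚᵘ-ℤtoℚ (+ ℤ.∣ x ∣)))))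

  ℤtoℚ-∑ : ∀ n (g : ℕ → ℤ) → ℤtoℚ (Sumℤ.∑ n g) ≡ Sumℚ.∑ n (ℤtoℚ ∘ g)
  ℤtoℚ-∑ zero    g = refl
  ℤtoℚ-∑ (suc n) g = trans (ℤtoℚ-+ (Sumℤ.∑ n g) (g n)) (cong (_+ ℤtoℚ (g n)) (ℤtoℚ-∑ n g))

  invℕ-* : ∀ a b → invℕ (a ℕ.* b) ≡ invℕ a * invℕ b
  invℕ-* zero    b       = sym (ℚP.*-zeroˡ (invℕ b))
  invℕ-* (suc a) zero    rewrite ℕP.*-zeroʳ a = sym (ℚP.*-zeroʳ (invℕ (suc a)))
  invℕ-* (suc a) (suc b) = toℚᵘ-injective (ℚᵘP.≃-trans (toℚᵘ-invℕ (b ℕ.+ a ℕ.* suc b)) (ℚᵘP.≃-trans (*≡* refl)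
    (ℚᵘP.≃-sym (ℚᵘP.≃-trans (toℚᵘ-homo-* (invℕ (suc a)) (invℕ (suc b)))
                            (ℚᵘP.*-cong (toℚᵘ-invℕ a) (toℚᵘ-invℕ b))))))

  ℕtoℚ*invℕ : ∀ d → ℕtoℚ (suc d) * invℕ (suc d) ≡ 1ℚ
  ℕtoℚ*invℕ d = toℚᵘ-injective (ℚᵘP.≃-trans (toℚᵘ-homo-* (ℕtoℚ (suc d)) (invℕ (suc d)))
    (ℚᵘP.≃-trans (ℚᵘP.*-cong (toℚᵘ-ℤtoℚ (+ suc d)) (toℚᵘ-invℕ d))
      (*≡* (solve 1 (λ x → x :* con (+ 1) :* con (+ 1) := con (+ 1) :* (con (+ 1) :* x)) refl (+ suc d)))))

  invℕ-nonNeg : ∀ d → 0ℚ ≤ invℕ d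
  invℕ-nonNeg zero    = ℚP.≤-refl
  invℕ-nonNeg (suc d) = toℚᵘ-cancel-≤ (ℚᵘP.≤-respʳ-≃ (ℚᵘP.≃-sym (toℚᵘ-invℕ d)) (*≤* (+≤+ z≤n)))

  ∣invℕ∣ : ∀ d → ∣ invℕ d ∣ ≡ invℕ d
  ∣invℕ∣ d = ℚP.0≤p⇒∣p∣≡p (invℕ-nonNeg d)

  invℕ-antimono : ∀ a b → a ℕ.≤ b → invℕ (suc b) ≤ invℕ (suc a)
  invℕ-antimono a b a≤b = toℚᵘ-cancel-≤
    (ℚᵘP.≤-respʳ-≃ (ℚᵘP.≃-sym (toℚᵘ-invℕ a)) (ℚᵘP.≤-respˡ-≃ (ℚᵘP.≃-sym (toℚᵘ-invℕ b))
      (*≤* (+≤+ (ℕP.+-mono-≤ (s≤s a≤b) z≤n)))))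

  invℕ-denominator≤ : ∀ ε → 0ℚ < ε → invℕ (↧ₙ ε) ≤ ε
  invℕ-denominator≤ (mkℚ (+ suc n) d _) _ = toℚᵘ-cancel-≤ (ℚᵘP.≤-respˡ-≃ (ℚᵘP.≃-sym (toℚᵘ-invℕ d))
    (*≤* (+≤+ (ℕP.*-monoˡ-≤ (suc d) {1} {suc n} (s≤s z≤n)))))
  invℕ-denominator≤ (mkℚ (+ zero)   d _) (*<* 0<0) = ⊥-elim (ℤP.<-irrefl refl 0<0)
  invℕ-denominator≤ (mkℚ -[1+ n ]   d _) (*<* ())

module Asymptotics where

  open Permutations using (length-perms)
  open Factorials using (fall-*-!)
  open FactorialSeries using (series; Expansion; expansion)
  open IndecomposableExpansion using (P; D; Δ²; D0-suc; expansion-P)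
  open RationalArithmetic
  open Data.Nat using (_!; s≤s⁻¹)
  open ℤ using (ℤ; +_; +≤+)
  open List using (map; foldr; applyUpTo; upTo)
  open ℚ using (ℚ; 0ℚ; 1ℚ; _+_; _-_; _*_; _≤_; ∣_∣; ↧ₙ_; nonNegative)
  open import Data.Rational.Solver using (module +-*-Solver)
  open +-*-Solver using (solve; _:*_; _:-_; _:=_)

  foldr-map-applyUpTo : ∀ n (h : ℕ → ℕ) (g : ℕ → ℚ) → foldr _+_ 0ℚ (map g (applyUpTo h n)) ≡ Sumℚ.∑ n (g ∘ h)
  foldr-map-applyUpTo zero    h g = refl
  foldr-map-applyUpTo (suc n) h g =
    trans (cong (_+_ (g (h 0))) (foldr-map-applyUpTo n (h ∘ suc) g)) (sym (Sumℚ.∑-head n (g ∘ h)))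

  sumRange-0 : ∀ r g → sumRange 0 r g ≡ Sumℚ.∑ (suc r) g
  sumRange-0 r g = foldr-map-applyUpTo (suc r) (λ i → i) g

  sumRange-cong : ∀ a r {g h : ℕ → ℚ} → (∀ k → g k ≡ h k) → sumRange a r g ≡ sumRange a r h
  sumRange-cong a r g≡h = cong (foldr _+_ 0ℚ) (ListP.map-cong (λ i → g≡h (a ℕ.+ i)) (upTo (suc r ∸ a)))

  invℕ-fall : ∀ n k → k ℕ.≤ n → invℕ (fall n k) ≡ ℕtoℚ ((n ∸ k) !) * invℕ (n !)
  invℕ-fall n k k≤n = sym (begin
    ℕtoℚ x * invℕ (n !)                   ≡⟨ cong (λ y → ℕtoℚ x * invℕ y) (sym (fall-*-! n k k≤n)) ⟩
    ℕtoℚ x * invℕ (fall n k ℕ.* x)        ≡⟨ cong (ℕtoℚ x *_) (invℕ-* (fall n k) x) ⟩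
    ℕtoℚ x * (invℕ (fall n k) * invℕ x)   ≡⟨ solve 3 (λ a b c → a :* (b :* c) := b :* (a :* c))
                                                   refl (ℕtoℚ x) (invℕ (fall n k)) (invℕ x) ⟩
    invℕ (fall n k) * (ℕtoℚ x * invℕ x)   ≡⟨ cong (invℕ (fall n k) *_) (cancel x (ℕP.1≤n! (n ∸ k))) ⟩
    invℕ (fall n k) * 1ℚ                  ≡⟨ ℚP.*-identityʳ _ ⟩
    invℕ (fall n k)                       ∎)
    where
    open ≡-Reasoning
    x = (n ∸ k) !
    cancel : ∀ y → 1 ℕ.≤ y → ℕtoℚ y * invℕ y ≡ 1ℚ
    cancel (suc y) _ = ℕtoℚ*invℕ y

  truncation-error : ∀ (a α : ℕ → ℤ) r n → r ℕ.< n →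
    ℤtoℚ (a n) * invℕ (n !) - sumRange 0 r (λ k → ℤtoℚ (α k) * f k n) ≡ ℤtoℚ (a n ℤ.- series α r n) * invℕ (n !)
  truncation-error a α r n r<n = begin
    ℤtoℚ (a n) * I - sumRange 0 r (λ k → ℤtoℚ (α k) * f k n)
      ≡⟨ cong (_-_ (ℤtoℚ (a n) * I)) (trans (sumRange-0 r _) (Sumℚ.∑-cong (suc r) term)) ⟩
    ℤtoℚ (a n) * I - Sumℚ.∑ (suc r) (λ k → ℤtoℚ (α k ℤ.* + ((n ∸ k) !)) * I)
      ≡⟨ cong (_-_ (ℤtoℚ (a n) * I)) (trans (Sumℚ.∑-*ʳ (suc r) I _) (cong (_* I) (sym (ℤtoℚ-∑ (suc r) _)))) ⟩
    ℤtoℚ (a n) * I - ℤtoℚ (series α r n) * I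
      ≡⟨ solve 3 (λ x y i → x :* i :- y :* i := (x :- y) :* i) refl (ℤtoℚ (a n)) (ℤtoℚ (series α r n)) I ⟩
    (ℤtoℚ (a n) - ℤtoℚ (series α r n)) * I
      ≡⟨ cong (_* I) (sym (ℤtoℚ-− (a n) (series α r n))) ⟩
    ℤtoℚ (a n ℤ.- series α r n) * I
      ∎
    where
    open ≡-Reasoning
    I = invℕ (n !)
    term : ∀ k → k ℕ.< suc r → ℤtoℚ (α k) * f k n ≡ ℤtoℚ (α k ℤ.* + ((n ∸ k) !)) * I
    term k k≤r = begin
      ℤtoℚ (α k) * invℕ (fall n k)
        ≡⟨ cong (ℤtoℚ (α k) *_) (invℕ-fall n k (ℕP.≤-trans (s≤s⁻¹ k≤r) (ℕP.<⇒≤ r<n))) ⟩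
      ℤtoℚ (α k) * (ℤtoℚ (+ ((n ∸ k) !)) * I)
        ≡⟨ ℚP.*-assoc (ℤtoℚ (α k)) _ I ⟨
      ℤtoℚ (α k) * ℤtoℚ (+ ((n ∸ k) !)) * I
        ≡⟨ cong (_* I) (ℤtoℚ-* (α k) (+ ((n ∸ k) !))) ⟨
      ℤtoℚ (α k ℤ.* + ((n ∸ k) !)) * I
        ∎

  fraction-bound : ∀ z C r n → ℤ.∣ z ∣ ℕ.≤ C ℕ.* (n ∸ suc r) ! → r ℕ.< n →
    ∣ ℤtoℚ z * invℕ (n !) ∣ ≤ ℕtoℚ C * ∣ f (suc r) n ∣
  fraction-bound z C r n ∣z∣≤ r<n = begin
    ∣ ℤtoℚ z * I ∣
      ≡⟨ ℚP.∣p*q∣≡∣p∣*∣q∣ (ℤtoℚ z) I ⟩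
    ∣ ℤtoℚ z ∣ * ∣ I ∣
      ≡⟨ cong₂ _*_ (∣ℤtoℚ∣ z) (∣invℕ∣ (n !)) ⟩
    ℕtoℚ ℤ.∣ z ∣ * I
      ≤⟨ ℚP.*-monoʳ-≤-nonNeg I {{nonNegative (invℕ-nonNeg (n !))}} (ℤtoℚ-mono-≤ (+≤+ ∣z∣≤)) ⟩
    ℕtoℚ (C ℕ.* (n ∸ suc r) !) * I
      ≡⟨ cong (_* I) (trans (cong ℤtoℚ (ℤP.pos-* C _)) (ℤtoℚ-* (+ C) (+ ((n ∸ suc r) !)))) ⟩
    ℕtoℚ C * ℕtoℚ ((n ∸ suc r) !) * I
      ≡⟨ ℚP.*-assoc (ℕtoℚ C) _ I ⟩
    ℕtoℚ C * (ℕtoℚ ((n ∸ suc r) !) * I)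
      ≡⟨ cong (ℕtoℚ C *_) (trans (sym (invℕ-fall n (suc r) r<n)) (sym (∣invℕ∣ (fall n (suc r))))) ⟩
    ℕtoℚ C * ∣ f (suc r) n ∣
      ∎
    where
    open ℚP.≤-Reasoning
    I = invℕ (n !)

  expansion⇒BigO : ∀ {a α} r → Expansion a α r →
    BigO (λ n → ℤtoℚ (a n) * invℕ (n !) - sumRange 0 r (λ k → ℤtoℚ (α k) * f k n)) (f (suc r))
  expansion⇒BigO {a} {α} r (expansion C N bound) = ℕtoℚ C , N ℕ.+ suc r , λ n N+r<n →
    let r<n = ℕP.m+n≤o⇒n≤o N N+r<n in
    subst (λ x → ∣ x ∣ ≤ ℕtoℚ C * ∣ f (suc r) n ∣) (sym (truncation-error a α r n r<n))
      (fraction-bound (a n ℤ.- series α r n) C r n (bound n (ℕP.m+n≤o⇒m≤o N N+r<n)) r<n)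

  f-littleO : ∀ k → LittleO (f (suc k)) (f k)
  f-littleO k ε ε>0 = ↧ₙ ε ℕ.+ k , λ n d+k≤n → begin
    ∣ f (suc k) n ∣
      ≡⟨ ∣invℕ∣ ((n ∸ k) ℕ.* fall n k) ⟩
    invℕ ((n ∸ k) ℕ.* fall n k)
      ≡⟨ invℕ-* (n ∸ k) (fall n k) ⟩
    invℕ (n ∸ k) * invℕ (fall n k)
      ≤⟨ ℚP.*-monoʳ-≤-nonNeg (invℕ (fall n k)) {{nonNegative (invℕ-nonNeg (fall n k))}}
                            (small (n ∸ k) (ℕP.m+n≤o⇒m≤o∸n (↧ₙ ε) d+k≤n)) ⟩
    ε * invℕ (fall n k)
      ≡⟨ cong (ε *_) (sym (∣invℕ∣ (fall n k))) ⟩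
    ε * ∣ f k n ∣
      ∎
    where
    open ℚP.≤-Reasoning
    small : ∀ m → ↧ₙ ε ℕ.≤ m → invℕ m ≤ ε
    small (suc m) d≤m = ℚP.≤-trans (invℕ-antimono _ m (s≤s⁻¹ d≤m)) (invℕ-denominator≤ ε ε>0)

  BigO-cong : ∀ {x y g : ℕ → ℚ} → (∀ n → x n ≡ y n) → BigO x g → BigO y g
  BigO-cong {g = g} x≡y (C , N , bound) = C , N , λ n N≤n → subst (λ v → ∣ v ∣ ≤ C * ∣ g n ∣) (x≡y n) (bound n N≤n)

  Approx-coeff-cong : ∀ {x c c′ F m} → (∀ k → c k ≡ c′ k) → Approx x c F m → Approx x c′ F m
  Approx-coeff-cong {x} {F = F} {m} c≡c′ (bigO , littleO) = bigO′ , littleO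
    where
    bigO′ = λ r m≤r → BigO-cong (λ n → cong (_-_ (x n)) (sumRange-cong m r (λ k → cong (_* F k n) (c≡c′ k)))) (bigO r m≤r)

  probParts-fraction : ∀ n m → probParts n m ≡ ℤtoℚ (P m n) * invℕ (n !)
  probParts-fraction n m = cong (λ d → ℕtoℚ (ip n m) * invℕ d) (length-perms n)

  coeffParts-ℤ : ∀ m k → coeffParts m k ≡ ℤtoℚ (D m k)
  coeffParts-ℤ m k = sym (ℤtoℚ-* (+ suc m) (Δ² m k))

  coeffIndec≡coeffParts : ∀ k → coeffIndec k ≡ coeffParts 0 k
  coeffIndec≡coeffParts zero    = refl
  coeffIndec≡coeffParts (suc k) = sym (trans (coeffParts-ℤ 0 (suc k)) (cong ℤtoℚ (D0-suc k)))

  approx-parts : ∀ m → Approx (λ n → probParts n (suc m)) (coeffParts m) f 0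
  approx-parts m = (λ r _ → BigO-cong (same-error r) (expansion⇒BigO r (expansion-P m r))) , (λ k _ → f-littleO k)
    where
    same-error : ∀ r n → ℤtoℚ (P (suc m) n) * invℕ (n !) - sumRange 0 r (λ k → ℤtoℚ (D m k) * f k n)
                       ≡ probParts n (suc m) - sumRange 0 r (λ k → coeffParts m k * f k n)
    same-error r n = cong₂ _-_ (sym (probParts-fraction n (suc m))) (sumRange-cong 0 r (λ k → cong (_* f k n) (sym (coeffParts-ℤ m k))))

open Asymptotics using (approx-parts; Approx-coeff-cong; coeffIndec≡coeffParts)

proposition4p6 : (∀ (m : ℕ) → 1 Data.Nat.≤ m →
    Approx (λ n → probParts n m) (coeffParts (m Data.Nat.∸ 1)) f 0)
    × Approx (λ n → probParts n 1) coeffIndec f 0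
proposition4p6 = (λ { (suc m) _ → approx-parts m })
               , Approx-coeff-cong {x = λ n → probParts n 1} (sym ∘ coeffIndec≡coeffParts) (approx-parts 0)
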